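{- Let $G$ be a graph with a vertex $v$, and let $U=aA+dD$ with fixed reals $a\neq0$, $d$. If $u_1$ is a $U$-Wronskian vertex of $G_v^1$, then for every $n\ge1$, $u_n$ is a $U$-Wronskian vertex of $G_v^n$.
   Context: Graphs are finite and simple; $A$ is the adjacency matrix, $D$ the diagonal degree matrix, and $U(G)=aA(G)+dD(G)$. $G_v^n$ is the graph obtained from $G$ by attaching at $v$ a pendant path $v u_1 u_2\cdots u_n$ of length $n$ (new vertices $u_1,\dots,u_n$), so $u_n$ is the pendant end. $\phi(X,x)=\det(xI-X)$. For a vertex $w$ of a graph $H$, $U^w(H)$ is the principal submatrix of $U(H)$ obtained by deleting the row and column of $w$; $w$ is a $U$-Wronskian vertex of $H$ if $\phi(U(H),x)\phi'(U^w(H),x)-\phi'(U(H),x)\phi(U^w(H),x)\neq0$ for all real $x$. -}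

module Defs where

open import Level using (0ℓ)
open import Data.Nat using (ℕ; zero; suc; pred)
open import Data.Fin using (Fin; zero; suc; punchIn; toℕ; _≟_)
open import Data.Bool using (Bool; true; false; if_then_else_)
open import Data.List using (List; []; _∷_; map)
open import Data.Product using (Σ; ∃; _×_; _,_; proj₁; proj₂)
open import Data.Sum using (_⊎_)
open import Relation.Nullary using (¬_)
open import Relation.Nullary.Decidable using (isYes)
open import Relation.Binary using (Rel; IsStrictTotalOrder)
open import Relation.Binary.PropositionalEquality using (_≡_; refl)
open import Algebra.Bundles using (CommutativeRing)

-- The real numbers, axiomatised as a Dedekind-complete ordered field
-- (this characterises ℝ up to isomorphism).  The theorem is stated for
-- every such structure.

record CompleteOrderedField : Set₁ where
  field
    commutativeRing : CommutativeRing 0ℓ 0ℓ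
  open CommutativeRing commutativeRing public
  field
    _<_                  : Rel Carrier 0ℓ
    0≉1                  : ¬ (0# ≈ 1#)
    inverse              : ∀ x → ¬ (x ≈ 0#) → ∃ λ y → (x * y) ≈ 1#
    <-isStrictTotalOrder : IsStrictTotalOrder _≈_ _<_
    +-mono-<             : ∀ {x y} z → x < y → (x + z) < (y + z)
    *-pos                : ∀ {x y} → 0# < x → 0# < y → 0# < (x * y)

  _≤_ : Rel Carrier 0ℓ
  x ≤ y = (x < y) ⊎ (x ≈ y)

  field
    complete : ∀ (P : Carrier → Set) → ∃ P → (∃ λ b → ∀ x → P x → x ≤ b) →
               ∃ λ s → (∀ x → P x → x ≤ s) × (∀ b → (∀ x → P x → x ≤ b) → s ≤ b)

record Graph : Set where
  field
    size    : ℕ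
    adj     : Fin size → Fin size → Bool
    symm    : ∀ i j → adj i j ≡ adj j i
    irrefl  : ∀ i → adj i i ≡ false

open Graph public

-- Attach a new (pendant) vertex, numbered zero, adjacent exactly to w;
-- the old vertex i becomes suc i.
attach : (H : Graph) → Fin (size H) → Graph
attach H w = record { size = suc (size H) ; adj = ad ; symm = sy ; irrefl = ir }
  where
  ad : Fin (suc (size H)) → Fin (suc (size H)) → Bool
  ad zero    zero    = false
  ad zero    (suc j) = isYes (j ≟ w)
  ad (suc i) zero    = isYes (i ≟ w)
  ad (suc i) (suc j) = adj H i j
  sy : ∀ i j → ad i j ≡ ad j i
  sy zero    zero    = refl
  sy zero    (suc j) = refl
  sy (suc i) zero    = refl
  sy (suc i) (suc j) = symm H i j
  ir : ∀ i → ad i i ≡ false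
  ir zero    = refl
  ir (suc i) = irrefl H i

-- pendantPath G v n = (G_v^n , u_n)  (for n = 0 this is (G , v)).
pendantPath : (G : Graph) → Fin (size G) → ℕ → Σ Graph (λ H → Fin (size H))
pendantPath G v zero    = G , v
pendantPath G v (suc n) = attach (proj₁ (pendantPath G v n)) (proj₂ (pendantPath G v n)) , zero

pathGraph : (G : Graph) → Fin (size G) → ℕ → Graph
pathGraph G v n = proj₁ (pendantPath G v n)

pathEnd : (G : Graph) (v : Fin (size G)) (n : ℕ) → Fin (size (pathGraph G v n))
pathEnd G v n = proj₂ (pendantPath G v n)

module _ (ℝ : CompleteOrderedField) where
  open CompleteOrderedField ℝ using (Carrier; _≈_; _+_; _*_; -_; 0#; 1#)

  Matrix : ℕ → Set
  Matrix k = Fin k → Fin k → Carrier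

  sumFin : ∀ {k} → (Fin k → Carrier) → Carrier
  sumFin {zero}  f = 0#
  sumFin {suc k} f = f zero + sumFin (λ i → f (suc i))

  boolC : Bool → Carrier
  boolC b = if b then 1# else 0#

  degree : (H : Graph) → Fin (size H) → Carrier
  degree H i = sumFin (λ j → boolC (adj H i j))

  UMat : Carrier → Carrier → (H : Graph) → Matrix (size H)
  UMat a d H i j = (a * boolC (adj H i j)) + (d * boolC (isYes (i ≟ j)) * degree H i)

  deleteRC : ∀ {k} → Fin k → Matrix k → Matrix (pred k)
  deleteRC {suc k} w M i j = M (punchIn w i) (punchIn w j)

  UMatDel : Carrier → Carrier → (H : Graph) → Fin (size H) → Matrix (pred (size H))
  UMatDel a d H w = deleteRC w (UMat a d H)

  -- polynomials: coefficient lists, constant term first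
  Poly : Set
  Poly = List Carrier

  _+P_ : Poly → Poly → Poly
  []      +P q       = q
  (x ∷ p) +P []      = x ∷ p
  (x ∷ p) +P (y ∷ q) = (x + y) ∷ (p +P q)

  scaleP : Carrier → Poly → Poly
  scaleP c p = map (c *_) p

  _*P_ : Poly → Poly → Poly
  []      *P q = []
  (x ∷ p) *P q = scaleP x q +P (0# ∷ (p *P q))

  negP : Poly → Poly
  negP = map -_

  natC : ℕ → Carrier
  natC zero    = 0#
  natC (suc n) = 1# + natC n

  derivFrom : ℕ → Poly → Poly
  derivFrom k []      = []
  derivFrom k (x ∷ p) = (natC k * x) ∷ derivFrom (suc k) p

  derivP : Poly → Poly
  derivP []      = []
  derivP (x ∷ p) = derivFrom 1 p

  evalP : Poly → Carrier → Carrier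
  evalP []      x = 0#
  evalP (c ∷ p) x = c + (x * evalP p x)

  sumP : ∀ {k} → (Fin k → Poly) → Poly
  sumP {zero}  f = []
  sumP {suc k} f = f zero +P sumP (λ i → f (suc i))

  signP : ℕ → Poly → Poly
  signP zero          p = p
  signP (suc zero)    p = negP p
  signP (suc (suc n)) p = signP n p

  detP : ∀ k → (Fin k → Fin k → Poly) → Poly
  detP zero    M = 1# ∷ []
  detP (suc k) M = sumP (λ j → signP (toℕ j) (M zero j *P detP k (λ r s → M (suc r) (punchIn j s))))

  charPoly : ∀ {k} → Matrix k → Poly
  charPoly {k} X = detP k (λ i j → if isYes (i ≟ j) then (- X i j) ∷ 1# ∷ [] else (- X i j) ∷ [])

  IsWronskian : Carrier → Carrier → (H : Graph) → Fin (size H) → Set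
  IsWronskian a d H w =
    ∀ (x : Carrier) →
      ¬ (evalP ((P *P derivP Q) +P negP (derivP P *P Q)) x ≈ 0#)
    where
    P = charPoly (UMat a d H)
    Q = charPoly (UMatDel a d H w)

Fin' : Graph → Set
Fin' G = Fin (size G)

{-# OPTIONS --safe #-}
module Submission where

-- Write Pₙ = φ(U(G_v^n)), Qₙ = φ(U^{uₙ}(G_v^n)) and Wₙ = Pₙ Qₙ′ − Pₙ′ Qₙ.  Expanding the
-- determinants along the new pendant vertex gives Qₙ₊₁ = Pₙ − d Qₙ and
-- Pₙ₊₁ = (x − d) Qₙ₊₁ − a² Qₙ, hence Wₙ₊₁ = a² Wₙ − Qₙ₊₁².  Since P₁ and Q₁ are monic of
-- degrees k + 1 and k, W₁ has leading term −x^{2k} and is negative for large x; having no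
-- real zero, it is negative everywhere (a supremum argument, the only use of completeness).
-- With a ≠ 0 the recurrence keeps every Wₙ negative.  Derivatives need no separate
-- treatment: evaluating a polynomial p at the dual number x + ε gives (p(x), p′(x)), so each
-- determinant identity, evaluated there, also yields the identity for the derivatives.

open import Algebra.Bundles using (CommutativeRing; AbelianGroup)
open import Algebra.Morphism.Structures using (module RingMorphisms)
open import Data.Bool using (true; false; if_then_else_)
open import Data.Empty using (⊥; ⊥-elim)
open import Data.Fin using (Fin; zero; suc; punchIn; toℕ; _≟_)
open import Data.Integer as ℤ using (ℤ; -[1+_]; _⊖_; _◃_; 0ℤ; 1ℤ; +-*-rawRing)
open import Data.Integer.Properties using ([1+m]⊖[1+n]≡m⊖n)
open import Data.List using ([]; _∷_)
open import Data.Maybe using (Maybe; just; nothing)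
open import Data.Nat as ℕ using (ℕ; zero; suc; s≤s; z≤n)
import Data.Nat.Properties as ℕₚ
open import Data.Product using (_×_; _,_; proj₁; proj₂; ∃)
import Data.Sign as Sign
open import Data.Sum using (inj₁; inj₂)
open import Function using (_∘_)
open import Relation.Binary.Definitions using (tri<; tri≈; tri>)
open import Relation.Binary.PropositionalEquality as ≡ using (_≡_)
import Relation.Binary.Reasoning.StrictPartialOrder
open import Relation.Nullary using (¬_; yes; no)
open import Relation.Nullary.Decidable using (isYes; ⌊⌋-map′)

open import Defs

module IntegerCoefficientSolver {c ℓ} (R : CommutativeRing c ℓ) where
  open import Data.Integer using (+_)
  open CommutativeRing R
  open import Algebra.Properties.Ring ring using (-‿involutive; -‿distribˡ-*; -‿distribʳ-*; -0#≈0#)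
  open import Algebra.Properties.AbelianGroup +-abelianGroup using (⁻¹-∙-comm)
  open import Algebra.Properties.CommutativeSemigroup +-commutativeSemigroup using (interchange)
  open import Algebra.Properties.Semiring.Mult.TCOptimised semiring
    using (×-homo-+; ×1-homo-*) renaming (_×_ to _×ᵣ_)
  open import Algebra.Solver.Ring.AlmostCommutativeRing
    using (fromCommutativeRing; _-Raw-AlmostCommutative⟶_)
  open import Relation.Binary.Reasoning.Setoid setoid

  -- The optimised multiples make fromℤ 0ℤ and fromℤ 1ℤ reduce to 0# and 1#, so that
  -- con 0ℤ and con 1ℤ denote the ring's own constants in the goals given to solve.
  fromℤ : ℤ → Carrier
  fromℤ (+ n)    = n ×ᵣ 1#
  fromℤ -[1+ n ] = - (suc n ×ᵣ 1#)

  fromℤ-neg : ∀ i → fromℤ (ℤ.- i) ≈ - fromℤ i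
  fromℤ-neg (+ zero)  = sym -0#≈0#
  fromℤ-neg (+ suc n) = refl
  fromℤ-neg -[1+ n ]  = sym (-‿involutive _)

  fromℤ-⊖ : ∀ m n → fromℤ (m ⊖ n) ≈ m ×ᵣ 1# - n ×ᵣ 1#
  fromℤ-⊖ zero    zero    = sym (-‿inverseʳ 0#)
  fromℤ-⊖ zero    (suc n) = sym (+-identityˡ _)
  fromℤ-⊖ (suc m) zero    = sym (trans (+-congˡ -0#≈0#) (+-identityʳ _))
  fromℤ-⊖ (suc m) (suc n) = begin
    fromℤ (suc m ⊖ suc n)       ≡⟨ ≡.cong fromℤ ([1+m]⊖[1+n]≡m⊖n m n) ⟩
    fromℤ (m ⊖ n)               ≈⟨ fromℤ-⊖ m n ⟩
    a - b                       ≈⟨ +-identityˡ _ ⟨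
    0# + (a - b)                ≈⟨ +-congʳ (-‿inverseʳ 1#) ⟨
    (1# - 1#) + (a - b)         ≈⟨ interchange 1# (- 1#) a (- b) ⟩
    (1# + a) + (- 1# + - b)     ≈⟨ +-congˡ (⁻¹-∙-comm 1# b) ⟩
    (1# + a) - (1# + b)         ≈⟨ +-cong (×-homo-+ 1# 1 m) (-‿cong (×-homo-+ 1# 1 n)) ⟨
    suc m ×ᵣ 1# - suc n ×ᵣ 1#   ∎
    where a = m ×ᵣ 1#; b = n ×ᵣ 1#

  fromℤ-+ : ∀ i j → fromℤ (i ℤ.+ j) ≈ fromℤ i + fromℤ j
  fromℤ-+ (+ m)    (+ n)    = ×-homo-+ 1# m n
  fromℤ-+ (+ m)    -[1+ n ] = fromℤ-⊖ m (suc n)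
  fromℤ-+ -[1+ m ] (+ n)    = trans (fromℤ-⊖ n (suc m)) (+-comm _ _)
  fromℤ-+ -[1+ m ] -[1+ n ] = begin
    - (suc (suc (m ℕ.+ n)) ×ᵣ 1#)       ≡⟨ ≡.cong (λ k → - (suc k ×ᵣ 1#)) (≡.sym (ℕₚ.+-suc m n)) ⟩
    - ((suc m ℕ.+ suc n) ×ᵣ 1#)         ≈⟨ -‿cong (×-homo-+ 1# (suc m) (suc n)) ⟩
    - (suc m ×ᵣ 1# + suc n ×ᵣ 1#)       ≈⟨ ⁻¹-∙-comm _ _ ⟨
    - (suc m ×ᵣ 1#) + - (suc n ×ᵣ 1#)   ∎

  fromℤ-◃+ : ∀ n → fromℤ (Sign.+ ◃ n) ≈ n ×ᵣ 1#
  fromℤ-◃+ zero    = refl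
  fromℤ-◃+ (suc n) = refl

  fromℤ-◃- : ∀ n → fromℤ (Sign.- ◃ n) ≈ - (n ×ᵣ 1#)
  fromℤ-◃- zero    = sym -0#≈0#
  fromℤ-◃- (suc n) = refl

  fromℤ-* : ∀ i j → fromℤ (i ℤ.* j) ≈ fromℤ i * fromℤ j
  fromℤ-* (+ m)    (+ n)    = trans (fromℤ-◃+ (m ℕ.* n)) (×1-homo-* m n)
  fromℤ-* (+ m)    -[1+ n ] =
    trans (fromℤ-◃- (m ℕ.* suc n)) (trans (-‿cong (×1-homo-* m (suc n))) (-‿distribʳ-* _ _))
  fromℤ-* -[1+ m ] (+ n)    =
    trans (fromℤ-◃- (suc m ℕ.* n)) (trans (-‿cong (×1-homo-* (suc m) n)) (-‿distribˡ-* _ _))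
  fromℤ-* -[1+ m ] -[1+ n ] = begin
    fromℤ (Sign.+ ◃ (suc m ℕ.* suc n))   ≈⟨ fromℤ-◃+ (suc m ℕ.* suc n) ⟩
    (suc m ℕ.* suc n) ×ᵣ 1#              ≈⟨ ×1-homo-* (suc m) (suc n) ⟩
    x * y                                ≈⟨ -‿involutive _ ⟨
    - - (x * y)                          ≈⟨ -‿cong (-‿distribˡ-* x y) ⟩
    - (- x * y)                          ≈⟨ -‿distribʳ-* (- x) y ⟩
    - x * - y                            ∎
    where x = suc m ×ᵣ 1#; y = suc n ×ᵣ 1#

  homomorphism : +-*-rawRing -Raw-AlmostCommutative⟶ fromCommutativeRing R
  homomorphism = record
    { ⟦_⟧ = fromℤ ; +-homo = fromℤ-+ ; *-homo = fromℤ-* ; -‿homo = fromℤ-neg ; 0-homo = refl ; 1-homo = refl }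

  equal? : ∀ i j → Maybe (fromℤ i ≈ fromℤ j)
  equal? i j with i ℤ.≟ j
  ... | yes ≡.refl = just refl
  ... | no _       = nothing

  open import Algebra.Solver.Ring +-*-rawRing (fromCommutativeRing R) homomorphism equal? public
    using (solve; _:+_; _:*_; :-_; _:-_; con; _:=_)

isYes-suc : ∀ {n} (i j : Fin n) → isYes (suc i ≟ suc j) ≡ isYes (i ≟ j)
isYes-suc i j = ⌊⌋-map′ _ _ (i ≟ j)

module Determinant {c ℓ} (R : CommutativeRing c ℓ) where
  open CommutativeRing R hiding (zero)
  open import Algebra.Properties.Ring ring using (-0#≈0#)
  open import Algebra.Properties.Monoid.Sum +-monoid using (sum; sum-cong-≋; sum-replicate-zero)
  open IntegerCoefficientSolver R
  open import Relation.Binary.Reasoning.Setoid setoid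

  SquareMatrix : ℕ → Set c
  SquareMatrix k = Fin k → Fin k → Carrier

  signed : ℕ → Carrier → Carrier
  signed zero          x = x
  signed (suc zero)    x = - x
  signed (suc (suc n)) x = signed n x

  minor : ∀ {k} → Fin (suc k) → SquareMatrix (suc k) → SquareMatrix k
  minor j M r s = M (suc r) (punchIn j s)

  det : ∀ k → SquareMatrix k → Carrier
  det zero    M = 1#
  det (suc k) M = sum (λ j → signed (toℕ j) (M zero j * det k (minor j M)))

  signed-cong : ∀ n {x y} → x ≈ y → signed n x ≈ signed n y
  signed-cong zero          x≈y = x≈y
  signed-cong (suc zero)    x≈y = -‿cong x≈y
  signed-cong (suc (suc n)) x≈y = signed-cong n x≈y

  signed-zero : ∀ n {x} → x ≈ 0# → signed n x ≈ 0#
  signed-zero zero          x≈0 = x≈0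
  signed-zero (suc zero)    x≈0 = trans (-‿cong x≈0) -0#≈0#
  signed-zero (suc (suc n)) x≈0 = signed-zero n x≈0

  sum-zero : ∀ {k} {f : Fin k → Carrier} → (∀ i → f i ≈ 0#) → sum f ≈ 0#
  sum-zero {k} f≈0 = trans (sum-cong-≋ f≈0) (sum-replicate-zero k)

  det-cong : ∀ k {M N : SquareMatrix k} → (∀ i j → M i j ≈ N i j) → det k M ≈ det k N
  det-cong zero    M≈N = refl
  det-cong (suc k) M≈N = sum-cong-≋ λ j →
    signed-cong (toℕ j) (*-cong (M≈N zero j) (det-cong k λ r s → M≈N (suc r) (punchIn j s)))

  det-zeroColumn  : ∀ k (M : SquareMatrix (suc k)) → (∀ i → M i zero ≈ 0#) → det (suc k) M ≈ 0#
  det-firstColumn : ∀ k (M : SquareMatrix (suc k)) → (∀ r → M (suc r) zero ≈ 0#) →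
                    det (suc k) M ≈ M zero zero * det k (minor zero M)

  det-zeroColumn k M M·₀≈0 = begin
    det (suc k) M                        ≈⟨ det-firstColumn k M (M·₀≈0 ∘ suc) ⟩
    M zero zero * det k (minor zero M)   ≈⟨ *-congʳ (M·₀≈0 zero) ⟩
    0# * det k (minor zero M)            ≈⟨ zeroˡ _ ⟩
    0#                                   ∎

  det-firstColumn zero    M _      = +-identityʳ _
  det-firstColumn (suc k) M M·₀≈0 = trans (+-congˡ (sum-zero later-terms≈0)) (+-identityʳ _)
    where
    later-terms≈0 : ∀ t → signed (toℕ (suc t)) (M zero (suc t) * det (suc k) (minor (suc t) M)) ≈ 0#
    later-terms≈0 t = signed-zero (toℕ (suc t))
      (trans (*-congˡ (det-zeroColumn k (minor (suc t) M) M·₀≈0)) (zeroʳ (M zero (suc t))))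

  det-update₀₀ : ∀ k (A B : SquareMatrix (suc k)) e →
                 A zero zero ≈ B zero zero + e →
                 (∀ t → A zero (suc t) ≈ B zero (suc t)) →
                 (∀ r s → A (suc r) s ≈ B (suc r) s) →
                 det (suc k) A ≈ det (suc k) B + e * det k (minor zero B)
  det-update₀₀ k A B e A₀₀≈ A₀ₜ≈ Aᵣₛ≈ = begin
    A zero zero * det k (minor zero A) + later A
      ≈⟨ +-cong (*-cong A₀₀≈ (minors-agree zero))
                (sum-cong-≋ λ t → signed-cong (toℕ (suc t)) (*-cong (A₀ₜ≈ t) (minors-agree (suc t)))) ⟩
    (B zero zero + e) * d + later B
      ≈⟨ solve 4 (λ b e d l → (b :+ e) :* d :+ l := (b :* d :+ l) :+ e :* d) refl (B zero zero) e d (later B) ⟩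
    (B zero zero * d + later B) + e * d
      ∎
    where
    d = det k (minor zero B)
    later : SquareMatrix (suc k) → Carrier
    later M = sum (λ t → signed (toℕ (suc t)) (M zero (suc t) * det k (minor (suc t) M)))
    minors-agree : ∀ j → det k (minor j A) ≈ det k (minor j B)
    minors-agree j = det-cong k λ r s → Aᵣₛ≈ r (punchIn j s)

  det-pendant : ∀ k (C : SquareMatrix (suc (suc k))) →
                (∀ t → C zero (suc (suc t)) ≈ 0#) → (∀ r → C (suc (suc r)) zero ≈ 0#) →
                det (suc (suc k)) C ≈
                  C zero zero * det (suc k) (minor zero C)
                  - C zero (suc zero) * C (suc zero) zero * det k (λ r s → C (suc (suc r)) (suc (suc s)))
  det-pendant k C C₀ₜ≈0 Cᵣ₀≈0 = begin
    c₀₀ * d₀ + (- (c₀₁ * det (suc k) (minor (suc zero) C)) + later)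
      ≈⟨ +-congˡ (+-cong (-‿cong (*-congˡ (det-firstColumn k (minor (suc zero) C) Cᵣ₀≈0)))
                         (sum-zero λ t → signed-zero (toℕ t) (trans (*-congʳ (C₀ₜ≈0 t)) (zeroˡ _)))) ⟩
    c₀₀ * d₀ + (- (c₀₁ * (c₁₀ * d₂)) + 0#)
      ≈⟨ solve 5 (λ a d b c e → a :* d :+ (:- (b :* (c :* e)) :+ con 0ℤ) := a :* d :- b :* c :* e)
                 refl c₀₀ d₀ c₀₁ c₁₀ d₂ ⟩
    c₀₀ * d₀ - c₀₁ * c₁₀ * d₂
      ∎
    where
    c₀₀ = C zero zero
    c₀₁ = C zero (suc zero)
    c₁₀ = C (suc zero) zero
    d₀ = det (suc k) (minor zero C)
    d₂ = det k (λ r s → C (suc (suc r)) (suc (suc s)))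
    later = sum (λ t → signed (toℕ t) (C zero (suc (suc t)) * det (suc k) (minor (suc (suc t)) C)))

  identityMatrix : ∀ {k} → SquareMatrix k
  identityMatrix i j = if isYes (i ≟ j) then 1# else 0#

  det-identity : ∀ k → det k identityMatrix ≈ 1#
  det-identity zero    = refl
  det-identity (suc k) = begin
    det (suc k) identityMatrix               ≈⟨ det-firstColumn k identityMatrix (λ _ → refl) ⟩
    1# * det k (minor zero identityMatrix)   ≈⟨ *-identityˡ _ ⟩
    det k (minor zero identityMatrix)        ≈⟨ det-cong k minor≈identity ⟩
    det k identityMatrix                     ≈⟨ det-identity k ⟩
    1#                                       ∎
    where
    minor≈identity : ∀ r s → minor zero identityMatrix r s ≈ identityMatrix r s
    minor≈identity r s = reflexive (≡.cong (λ b → if b then 1# else 0#) (isYes-suc r s))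

module DualNumbers {c ℓ} (R : CommutativeRing c ℓ) where
  open CommutativeRing R
  open import Algebra.Construct.DirectProduct using (abelianGroup)
  open import Algebra.Properties.Ring ring using (-0#≈0#)
  open IntegerCoefficientSolver R
  open import Relation.Binary.Reasoning.Setoid setoid

  Dual : Set c
  Dual = Carrier × Carrier

  +ᵈ-abelianGroup : AbelianGroup c ℓ
  +ᵈ-abelianGroup = abelianGroup +-abelianGroup +-abelianGroup

  open AbelianGroup +ᵈ-abelianGroup public using ()
    renaming (_≈_ to infix 4 _≈ᵈ_; _∙_ to infixl 6 _+ᵈ_; _-_ to infixl 6 _-ᵈ_; ε to 0ᵈ; _⁻¹ to infix 8 -ᵈ_)

  infixl 7 _*ᵈ_
  _*ᵈ_ : Dual → Dual → Dual
  (a , a′) *ᵈ (b , b′) = a * b , a * b′ + a′ * b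

  dualRing : CommutativeRing c ℓ
  dualRing = record
    { _≈_ = _≈ᵈ_ ; _+_ = _+ᵈ_ ; _*_ = _*ᵈ_ ; -_ = -ᵈ_ ; 0# = 0ᵈ ; 1# = 1# , 0#
    ; isCommutativeRing = record
      { isRing = record
        { +-isAbelianGroup = AbelianGroup.isAbelianGroup +ᵈ-abelianGroup
        ; *-cong = λ (a≈b , a′≈b′) (c≈d , c′≈d′) →
            *-cong a≈b c≈d , +-cong (*-cong a≈b c′≈d′) (*-cong a′≈b′ c≈d)
        ; *-assoc = λ (a , a′) (b , b′) (c , c′) → *-assoc a b c ,
            solve 6 (λ a a′ b b′ c c′ → a :* b :* c′ :+ (a :* b′ :+ a′ :* b) :* c
                                      := a :* (b :* c′ :+ b′ :* c) :+ a′ :* (b :* c)) refl a a′ b b′ c c′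
        ; *-identity =
            (λ (a , a′) → *-identityˡ a , solve 2 (λ a a′ → con 1ℤ :* a′ :+ con 0ℤ :* a := a′) refl a a′) ,
            (λ (a , a′) → *-identityʳ a , solve 2 (λ a a′ → a :* con 0ℤ :+ a′ :* con 1ℤ := a′) refl a a′)
        ; distrib =
            (λ (a , a′) (b , b′) (c , c′) → distribˡ a b c ,
               solve 6 (λ a a′ b b′ c c′ → a :* (b′ :+ c′) :+ a′ :* (b :+ c)
                                         := (a :* b′ :+ a′ :* b) :+ (a :* c′ :+ a′ :* c)) refl a a′ b b′ c c′) ,
            (λ (a , a′) (b , b′) (c , c′) → distribʳ a b c ,
               solve 6 (λ a a′ b b′ c c′ → (b :+ c) :* a′ :+ (b′ :+ c′) :* a
                                         := (b :* a′ :+ b′ :* a) :+ (c :* a′ :+ c′ :* a)) refl a a′ b b′ c c′)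
        }
      ; *-comm = λ (a , a′) (b , b′) → *-comm a b ,
          solve 4 (λ a a′ b b′ → a :* b′ :+ a′ :* b := b :* a′ :+ b′ :* a) refl a a′ b b′
      }
    }

  const : Carrier → Dual
  const a = a , 0#

  open RingMorphisms rawRing (CommutativeRing.rawRing dualRing) using (IsRingHomomorphism)

  const-isRingHomomorphism : IsRingHomomorphism const
  const-isRingHomomorphism = record
    { isSemiringHomomorphism = record
      { isNearSemiringHomomorphism = record
        { +-isMonoidHomomorphism = record
          { isMagmaHomomorphism = record
            { isRelHomomorphism = record { cong = λ a≈b → a≈b , refl }
            ; homo = λ a b → refl , sym (+-identityʳ 0#)
            }
          ; ε-homo = refl , refl
          }
        ; *-homo = λ a b → refl , solve 2 (λ a b → con 0ℤ := a :* con 0ℤ :+ con 0ℤ :* b) refl a b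
        }
      ; 1#-homo = refl , refl
      }
    ; -‿homo = λ a → refl , sym -0#≈0#
    }

  wronskianᵈ : Dual → Dual → Carrier
  wronskianᵈ (f , f′) (g , g′) = f * g′ - f′ * g

  wronskianᵈ-recurrence : ∀ x b e {p q q₁ p₁ : Dual} →
                          q₁ ≈ᵈ p -ᵈ const b *ᵈ q →
                          p₁ ≈ᵈ ((x , 1#) -ᵈ const b) *ᵈ q₁ -ᵈ const e *ᵈ q →
                          wronskianᵈ p₁ q₁ ≈ e * wronskianᵈ p q - proj₁ q₁ * proj₁ q₁
  wronskianᵈ-recurrence x b e {p , p′} {q , q′} {Q , Q′} {P , P′} (Q≈ , Q′≈) (P≈ , P′≈) = begin
    P * Q′ - P′ * Q
      ≈⟨ +-cong (*-congʳ P≈) (-‿cong (*-congʳ P′≈)) ⟩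
    ((x - b) * Q - e * q) * Q′ - (((x - b) * Q′ + (1# - 0#) * Q) - (e * q′ + 0# * q)) * Q
      ≈⟨ solve 7 (λ x b e q q′ Q Q′ →
           ((x :- b) :* Q :- e :* q) :* Q′
             :- (((x :- b) :* Q′ :+ (con 1ℤ :- con 0ℤ) :* Q) :- (e :* q′ :+ con 0ℤ :* q)) :* Q
           := e :* (q′ :* Q :- q :* Q′) :- Q :* Q) refl x b e q q′ Q Q′ ⟩
    e * (q′ * Q - q * Q′) - Q * Q
      ≈⟨ +-congʳ (*-congˡ (+-cong (*-congˡ Q≈) (-‿cong (*-congˡ Q′≈)))) ⟩
    e * (q′ * (p - b * q) - q * (p′ - (b * q′ + 0# * q))) - Q * Q
      ≈⟨ +-congʳ (*-congˡ (solve 5 (λ b p p′ q q′ →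
           q′ :* (p :- b :* q) :- q :* (p′ :- (b :* q′ :+ con 0ℤ :* q)) := p :* q′ :- p′ :* q) refl b p p′ q q′)) ⟩
    e * (p * q′ - p′ * q) - Q * Q
      ∎

module PolynomialNotation (ℝ : CompleteOrderedField) where
  open CompleteOrderedField ℝ using (Carrier)

  infixl 6 _+ₚ_
  infixl 7 _*ₚ_ _·ₚ_
  infix  8 -ₚ_

  _+ₚ_ _*ₚ_ : Poly ℝ → Poly ℝ → Poly ℝ
  _+ₚ_ = _+P_ ℝ
  _*ₚ_ = _*P_ ℝ

  _·ₚ_ : Carrier → Poly ℝ → Poly ℝ
  _·ₚ_ = scaleP ℝ

  -ₚ_ ∂ : Poly ℝ → Poly ℝ
  -ₚ_ = negP ℝ
  ∂   = derivP ℝ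

  wronskian : Poly ℝ → Poly ℝ → Poly ℝ
  wronskian P Q = P *ₚ ∂ Q +ₚ -ₚ (∂ P *ₚ Q)

module Evaluation (ℝ : CompleteOrderedField) {c ℓ} (R : CommutativeRing c ℓ)
  (ι : CompleteOrderedField.Carrier ℝ → CommutativeRing.Carrier R)
  (ι-isRingHomomorphism : RingMorphisms.IsRingHomomorphism (CompleteOrderedField.rawRing ℝ)
                                                           (CommutativeRing.rawRing R) ι)
  (X : CommutativeRing.Carrier R) where

  open CommutativeRing R hiding (zero)
  open CompleteOrderedField ℝ using ()
    renaming (_≈_ to _≈ℝ_; _+_ to _+ℝ_; _*_ to _*ℝ_; -_ to -ℝ_; 0# to 0ℝ; 1# to 1ℝ)
  open RingMorphisms.IsRingHomomorphism ι-isRingHomomorphism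
  open Determinant R using (det; signed; signed-cong; det-cong)
  open import Algebra.Properties.Monoid.Sum +-monoid using (sum; sum-cong-≋)
  open import Algebra.Properties.Ring ring using (-0#≈0#; -‿distribʳ-*; -‿+-comm)
  open PolynomialNotation ℝ
  open IntegerCoefficientSolver R
  open import Relation.Binary.Reasoning.Setoid setoid

  eval : Poly ℝ → Carrier
  eval []      = 0#
  eval (a ∷ p) = ι a + X * eval p

  eval-+ : ∀ p q → eval (p +ₚ q) ≈ eval p + eval q
  eval-+ []      q       = sym (+-identityˡ _)
  eval-+ (a ∷ p) []      = sym (+-identityʳ _)
  eval-+ (a ∷ p) (b ∷ q) = begin
    ι (a +ℝ b) + X * eval (p +ₚ q)            ≈⟨ +-cong (+-homo a b) (*-congˡ (eval-+ p q)) ⟩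
    (ι a + ι b) + X * (eval p + eval q)       ≈⟨ solve 5 (λ a b x p q → (a :+ b) :+ x :* (p :+ q)
                                                                    := (a :+ x :* p) :+ (b :+ x :* q))
                                                         refl (ι a) (ι b) X (eval p) (eval q) ⟩
    (ι a + X * eval p) + (ι b + X * eval q)   ∎

  eval-· : ∀ a p → eval (a ·ₚ p) ≈ ι a * eval p
  eval-· a []      = sym (zeroʳ _)
  eval-· a (b ∷ p) = begin
    ι (a *ℝ b) + X * eval (a ·ₚ p)   ≈⟨ +-cong (*-homo a b) (*-congˡ (eval-· a p)) ⟩
    ι a * ι b + X * (ι a * eval p)   ≈⟨ solve 4 (λ a b x p → a :* b :+ x :* (a :* p) := a :* (b :+ x :* p))
                                                refl (ι a) (ι b) X (eval p) ⟩
    ι a * (ι b + X * eval p)         ∎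

  eval-* : ∀ p q → eval (p *ₚ q) ≈ eval p * eval q
  eval-* []      q = sym (zeroˡ _)
  eval-* (a ∷ p) q = begin
    eval (a ·ₚ q +ₚ (0ℝ ∷ p *ₚ q))                ≈⟨ eval-+ (a ·ₚ q) _ ⟩
    eval (a ·ₚ q) + (ι 0ℝ + X * eval (p *ₚ q))    ≈⟨ +-cong (eval-· a q) (+-cong 0#-homo (*-congˡ (eval-* p q))) ⟩
    ι a * eval q + (0# + X * (eval p * eval q))   ≈⟨ solve 4 (λ a q x p → a :* q :+ (con 0ℤ :+ x :* (p :* q))
                                                                      := (a :+ x :* p) :* q)
                                                             refl (ι a) (eval q) X (eval p) ⟩
    (ι a + X * eval p) * eval q                   ∎

  eval-neg : ∀ p → eval (-ₚ p) ≈ - eval p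
  eval-neg []      = sym -0#≈0#
  eval-neg (a ∷ p) = begin
    ι (-ℝ a) + X * eval (-ₚ p)   ≈⟨ +-cong (-‿homo a) (*-congˡ (eval-neg p)) ⟩
    - ι a + X * - eval p         ≈⟨ +-congˡ (-‿distribʳ-* X (eval p)) ⟨
    - ι a + - (X * eval p)       ≈⟨ -‿+-comm (ι a) (X * eval p) ⟩
    - (ι a + X * eval p)         ∎

  eval-sumP : ∀ {k} (f : Fin k → Poly ℝ) → eval (sumP ℝ f) ≈ sum (λ i → eval (f i))
  eval-sumP {zero}  f = refl
  eval-sumP {suc k} f = trans (eval-+ (f zero) _) (+-congˡ (eval-sumP (λ i → f (suc i))))

  eval-signP : ∀ n p → eval (signP ℝ n p) ≈ signed n (eval p)
  eval-signP zero          p = refl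
  eval-signP (suc zero)    p = eval-neg p
  eval-signP (suc (suc n)) p = eval-signP n p

  eval-detP : ∀ k (M : Fin k → Fin k → Poly ℝ) → eval (detP ℝ k M) ≈ det k (λ i j → eval (M i j))
  eval-detP zero    M = trans (+-cong 1#-homo (zeroʳ X)) (+-identityʳ 1#)
  eval-detP (suc k) M = trans (eval-sumP term) (sum-cong-≋ eval-term)
    where
    minorP : Fin (suc k) → Fin k → Fin k → Poly ℝ
    minorP j r s = M (suc r) (punchIn j s)
    term : Fin (suc k) → Poly ℝ
    term j = signP ℝ (toℕ j) (M zero j *ₚ detP ℝ k (minorP j))
    eval-term : ∀ j → eval (term j) ≈ signed (toℕ j) (eval (M zero j) * det k (λ r s → eval (minorP j r s)))
    eval-term j = trans (eval-signP (toℕ j) _)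
      (signed-cong (toℕ j) (trans (eval-* (M zero j) _) (*-congˡ (eval-detP k (minorP j)))))

  charMatrix : ∀ {k} → Matrix ℝ k → Fin k → Fin k → Carrier
  charMatrix M i j = (if isYes (i ≟ j) then X else 0#) - ι (M i j)

  charMatrix-cong : ∀ {k} (M N : Matrix ℝ k) i j → M i j ≈ℝ N i j → charMatrix M i j ≈ charMatrix N i j
  charMatrix-cong M N i j Mᵢⱼ≈Nᵢⱼ = +-congˡ (-‿cong (⟦⟧-cong Mᵢⱼ≈Nᵢⱼ))

  charMatrix-minor : ∀ {k} (M : Matrix ℝ (suc k)) (N : Matrix ℝ k) → (∀ r s → M (suc r) (suc s) ≈ℝ N r s) →
                     ∀ r s → charMatrix M (suc r) (suc s) ≈ charMatrix N r s
  charMatrix-minor M N M≈N r s =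
    +-cong (reflexive (≡.cong (λ b → if b then X else 0#) (isYes-suc r s))) (-‿cong (⟦⟧-cong (M≈N r s)))

  eval-charPoly : ∀ {k} (M : Matrix ℝ k) → eval (charPoly ℝ M) ≈ det k (charMatrix M)
  eval-charPoly {k} M = trans (eval-detP k _) (det-cong k λ i j → entry (isYes (i ≟ j)) (M i j))
    where
    entry : ∀ b u → eval (if b then (-ℝ u) ∷ 1ℝ ∷ [] else (-ℝ u) ∷ []) ≈ (if b then X else 0#) - ι u
    entry true  u = begin
      ι (-ℝ u) + X * (ι 1ℝ + X * 0#)   ≈⟨ +-cong (-‿homo u) (*-congˡ (+-cong 1#-homo (zeroʳ X))) ⟩
      - ι u + X * (1# + 0#)            ≈⟨ solve 2 (λ u x → :- u :+ x :* (con 1ℤ :+ con 0ℤ) := x :- u) refl (ι u) X ⟩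
      X - ι u                          ∎
    entry false u = begin
      ι (-ℝ u) + X * 0#                ≈⟨ +-cong (-‿homo u) (zeroʳ X) ⟩
      - ι u + 0#                       ≈⟨ +-comm _ _ ⟩
      0# - ι u                         ∎

module DualEvaluation (ℝ : CompleteOrderedField) (x : CompleteOrderedField.Carrier ℝ) where
  open CompleteOrderedField ℝ hiding (zero)
  open DualNumbers commutativeRing
  open Evaluation ℝ dualRing const const-isRingHomomorphism (x , 1#) public
  open PolynomialNotation ℝ
  open IntegerCoefficientSolver commutativeRing
  open import Relation.Binary.Reasoning.Setoid setoid
  private module D = CommutativeRing dualRing

  evalP-derivFrom : ∀ k p → evalP ℝ (derivFrom ℝ k p) x ≈ natC ℝ k * evalP ℝ p x + x * evalP ℝ (∂ p) x
  evalP-derivFrom k []      = solve 2 (λ n x → con 0ℤ := n :* con 0ℤ :+ x :* con 0ℤ) refl (natC ℝ k) x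
  evalP-derivFrom k (a ∷ p) = begin
    n * a + x * evalP ℝ (derivFrom ℝ (suc k) p) x     ≈⟨ +-congˡ (*-congˡ (evalP-derivFrom (suc k) p)) ⟩
    n * a + x * ((1# + n) * v + x * v′)               ≈⟨ solve 5 (λ n a x v v′ →
                                                           n :* a :+ x :* ((con 1ℤ :+ n) :* v :+ x :* v′)
                                                           := n :* (a :+ x :* v) :+ x :* ((con 1ℤ :+ con 0ℤ) :* v :+ x :* v′))
                                                           refl n a x v v′ ⟩
    n * (a + x * v) + x * ((1# + 0#) * v + x * v′)    ≈⟨ +-congˡ (*-congˡ (evalP-derivFrom 1 p)) ⟨
    n * (a + x * v) + x * evalP ℝ (derivFrom ℝ 1 p) x ∎
    where n = natC ℝ k; v = evalP ℝ p x; v′ = evalP ℝ (∂ p) x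

  eval-dual : ∀ p → eval p ≈ᵈ (evalP ℝ p x , evalP ℝ (∂ p) x)
  eval-dual []      = refl , refl
  eval-dual (a ∷ p) = +-congˡ (*-congˡ v≈) , (begin
    0# + (x * proj₂ (eval p) + 1# * proj₁ (eval p))   ≈⟨ +-congˡ (+-cong (*-congˡ v′≈) (*-congˡ v≈)) ⟩
    0# + (x * v′ + 1# * v)                            ≈⟨ solve 3 (λ x v v′ →
                                                           con 0ℤ :+ (x :* v′ :+ con 1ℤ :* v)
                                                           := (con 1ℤ :+ con 0ℤ) :* v :+ x :* v′) refl x v v′ ⟩
    (1# + 0#) * v + x * v′                            ≈⟨ evalP-derivFrom 1 p ⟨
    evalP ℝ (derivFrom ℝ 1 p) x                       ∎)
    where
    v = evalP ℝ p x; v′ = evalP ℝ (∂ p) x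
    v≈ = proj₁ (eval-dual p); v′≈ = proj₂ (eval-dual p)

  evalP≈proj₁-eval : ∀ p → evalP ℝ p x ≈ proj₁ (eval p)
  evalP≈proj₁-eval p = sym (proj₁ (eval-dual p))

  evalP-neg : ∀ p → evalP ℝ (-ₚ p) x ≈ - evalP ℝ p x
  evalP-neg p = trans (evalP≈proj₁-eval (-ₚ p)) (trans (proj₁ (eval-neg p)) (-‿cong (proj₁ (eval-dual p))))

  evalP-wronskian : ∀ P Q → evalP ℝ (wronskian P Q) x ≈ wronskianᵈ (eval P) (eval Q)
  evalP-wronskian P Q = begin
    evalP ℝ (wronskian P Q) x
      ≈⟨ evalP≈proj₁-eval (wronskian P Q) ⟩
    proj₁ (eval (wronskian P Q))
      ≈⟨ proj₁ eval-W ⟩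
    proj₁ (eval P) * proj₁ (eval (∂ Q)) - proj₁ (eval (∂ P)) * proj₁ (eval Q)
      ≈⟨ +-cong (*-congˡ (∂-eval Q)) (-‿cong (*-congʳ (∂-eval P))) ⟩
    wronskianᵈ (eval P) (eval Q)
      ∎
    where
    eval-W : eval (wronskian P Q) ≈ᵈ eval P *ᵈ eval (∂ Q) -ᵈ eval (∂ P) *ᵈ eval Q
    eval-W = D.trans (eval-+ (P *ₚ ∂ Q) _)
                     (D.+-cong (eval-* P (∂ Q)) (D.trans (eval-neg (∂ P *ₚ Q)) (D.-‿cong (eval-* (∂ P) Q))))
    ∂-eval : ∀ p → proj₁ (eval (∂ p)) ≈ proj₂ (eval p)
    ∂-eval p = trans (proj₁ (eval-dual (∂ p))) (sym (proj₂ (eval-dual p)))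

module PendantVertex (ℝ : CompleteOrderedField) (a d : CompleteOrderedField.Carrier ℝ) where
  open CompleteOrderedField ℝ hiding (zero)
  open IntegerCoefficientSolver commutativeRing
  open PolynomialNotation ℝ
  open import Algebra.Properties.Monoid.Sum +-monoid using (sum; sum-cong-≋; sum-replicate-zero)
  open import Relation.Binary.Reasoning.Setoid setoid

  U : (H : Graph) → Matrix ℝ (size H)
  U = UMat ℝ a d

  charPolyU : Graph → Poly ℝ
  charPolyU H = charPoly ℝ (U H)

  charPolyUDel : (H : Graph) → Fin (size H) → Poly ℝ
  charPolyUDel H w = charPoly ℝ (UMatDel ℝ a d H w)

  wronskianAt : (H : Graph) → Fin (size H) → Poly ℝ
  wronskianAt H w = wronskian (charPolyU H) (charPolyUDel H w)

  sumFin≡sum : ∀ {k} (f : Fin k → Carrier) → sumFin ℝ f ≡ sum f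
  sumFin≡sum {zero}  f = ≡.refl
  sumFin≡sum {suc k} f = ≡.cong (f zero +_) (sumFin≡sum (λ i → f (suc i)))

  sum-indicator : ∀ {n} (w : Fin n) → sum (λ j → boolC ℝ (isYes (j ≟ w))) ≈ 1#
  sum-indicator {suc n} zero    = trans (+-congˡ (sum-replicate-zero n)) (+-identityʳ 1#)
  sum-indicator         (suc w) = begin
    0# + sum (λ j → boolC ℝ (isYes (suc j ≟ suc w)))   ≈⟨ +-identityˡ _ ⟩
    sum (λ j → boolC ℝ (isYes (suc j ≟ suc w)))        ≈⟨ sum-cong-≋ (λ j → reflexive (≡.cong (boolC ℝ) (isYes-suc j w))) ⟩
    sum (λ j → boolC ℝ (isYes (j ≟ w)))                ≈⟨ sum-indicator w ⟩
    1#                                                 ∎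

  degree-pendant : ∀ H w → degree ℝ (attach H w) zero ≈ 1#
  degree-pendant H w = begin
    degree ℝ (attach H w) zero                 ≡⟨ sumFin≡sum (λ j → boolC ℝ (adj (attach H w) zero j)) ⟩
    0# + sum (λ j → boolC ℝ (isYes (j ≟ w)))   ≈⟨ +-identityˡ _ ⟩
    sum (λ j → boolC ℝ (isYes (j ≟ w)))        ≈⟨ sum-indicator w ⟩
    1#                                         ∎

  U-attach-00 : ∀ H w → U (attach H w) zero zero ≈ d
  U-attach-00 H w = begin
    a * 0# + d * 1# * degree ℝ (attach H w) zero   ≈⟨ +-congˡ (*-congˡ (degree-pendant H w)) ⟩
    a * 0# + d * 1# * 1#                           ≈⟨ solve 2 (λ a d → a :* con 0ℤ :+ d :* con 1ℤ :* con 1ℤ := d) refl a d ⟩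
    d                                              ∎

  U-attach-0s : ∀ H w j → U (attach H w) zero (suc j) ≈ a * boolC ℝ (isYes (j ≟ w))
  U-attach-0s H w j = solve 4 (λ a b d g → a :* b :+ d :* con 0ℤ :* g := a :* b) refl a _ d _

  U-attach-s0 : ∀ H w i → U (attach H w) (suc i) zero ≈ a * boolC ℝ (isYes (i ≟ w))
  U-attach-s0 H w i = solve 4 (λ a b d g → a :* b :+ d :* con 0ℤ :* g := a :* b) refl a _ d _

  U-attach-ss : ∀ H w i j → U (attach H w) (suc i) (suc j) ≈
                            U H i j + d * boolC ℝ (isYes (i ≟ j)) * boolC ℝ (isYes (i ≟ w))
  U-attach-ss H w i j = begin
    a * A + d * boolC ℝ (isYes (suc i ≟ suc j)) * (b + g)
      ≡⟨ ≡.cong (λ t → a * A + d * boolC ℝ t * (b + g)) (isYes-suc i j) ⟩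
    a * A + d * δ * (b + g)
      ≈⟨ solve 6 (λ a A d δ b g → a :* A :+ d :* δ :* (b :+ g) := (a :* A :+ d :* δ :* g) :+ d :* δ :* b)
                 refl a A d δ b g ⟩
    (a * A + d * δ * g) + d * δ * b
      ∎
    where
    A = boolC ℝ (adj H i j)
    δ = boolC ℝ (isYes (i ≟ j))
    b = boolC ℝ (isYes (i ≟ w))
    g = degree ℝ H i

-- H = attach K u only so that H has a vertex 0, the current end of the path; H′ extends
-- the path by one more pendant vertex, again numbered 0.
module PendantStep (ℝ : CompleteOrderedField) (a d : CompleteOrderedField.Carrier ℝ)
                   (K : Graph) (u : Fin (size K)) (x : CompleteOrderedField.Carrier ℝ) where
  open CompleteOrderedField ℝ hiding (zero)
  open IntegerCoefficientSolver commutativeRing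
  open PolynomialNotation ℝ
  open PendantVertex ℝ a d
  open DualNumbers commutativeRing
  open DualEvaluation ℝ x
  open Determinant dualRing using (det; det-cong; det-update₀₀; det-pendant)
  open RingMorphisms.IsRingHomomorphism const-isRingHomomorphism using ()
    renaming (+-homo to const-+; *-homo to const-*; ⟦⟧-cong to const-cong)
  private
    module D where
      open CommutativeRing dualRing public
      open import Algebra.Properties.Ring (CommutativeRing.ring dualRing) public using (-‿distribˡ-*; -0#≈0#)
      open IntegerCoefficientSolver dualRing public

    H H′ : Graph
    H  = attach K u
    H′ = attach H zero

    m : ℕ
    m = size K

    X : Dual
    X = x , 1#

    U′₁₁≈ : U H′ (suc zero) (suc zero) ≈ U H zero zero + d
    U′₁₁≈ = trans (U-attach-ss H zero zero zero) (+-congˡ (trans (*-identityʳ _) (*-identityʳ d)))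

    U′₁ₜ≈ : ∀ t → U H′ (suc zero) (suc (suc t)) ≈ U H zero (suc t)
    U′₁ₜ≈ t = trans (U-attach-ss H zero zero (suc t))
                    (solve 3 (λ y d b → y :+ d :* con 0ℤ :* b := y) refl _ d _)

    U′ᵣₛ≈ : ∀ r s → U H′ (suc (suc r)) (suc s) ≈ U H (suc r) s
    U′ᵣₛ≈ r s = trans (U-attach-ss H zero (suc r) s)
                      (solve 3 (λ y d b → y :+ d :* b :* con 0ℤ := y) refl _ d _)

    off-diagonal : ∀ {v w} → v ≈ w → 0ᵈ -ᵈ const v ≈ᵈ -ᵈ const w
    off-diagonal v≈w = D.trans (D.+-identityˡ _) (D.-‿cong (const-cong v≈w))

    off-diagonal-zero : ∀ {v} → v ≈ 0# → 0ᵈ -ᵈ const v ≈ᵈ 0ᵈ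
    off-diagonal-zero v≈0 = D.trans (off-diagonal v≈0) D.-0#≈0#

  -- Deleting the new vertex of H′ leaves U(H), except that the old end has gained a neighbour.
  Q′-recurrence : det (suc m) (charMatrix (UMatDel ℝ a d H′ zero)) ≈ᵈ
                  det (suc m) (charMatrix (U H)) -ᵈ const d *ᵈ det m (charMatrix (UMatDel ℝ a d H zero))
  Q′-recurrence = begin
    det (suc m) A                               ≈⟨ det-update₀₀ m A B (-ᵈ const d) A₀₀≈ A₀ₜ≈ Aᵣₛ≈ ⟩
    det (suc m) B +ᵈ (-ᵈ const d) *ᵈ det m B₀   ≈⟨ D.+-congˡ (D.*-congˡ (det-cong m B₀≈C)) ⟩
    det (suc m) B +ᵈ (-ᵈ const d) *ᵈ det m C    ≈⟨ D.+-congˡ (D.-‿distribˡ-* (const d) _) ⟨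
    det (suc m) B -ᵈ const d *ᵈ det m C         ∎
    where
    open import Relation.Binary.Reasoning.Setoid D.setoid
    A B : Fin (suc m) → Fin (suc m) → Dual
    A = charMatrix (UMatDel ℝ a d H′ zero)
    B = charMatrix (U H)
    B₀ C : Fin m → Fin m → Dual
    B₀ r s = B (suc r) (suc s)
    C = charMatrix (UMatDel ℝ a d H zero)
    A₀₀≈ : A zero zero ≈ᵈ B zero zero +ᵈ -ᵈ const d
    A₀₀≈ = begin
      X -ᵈ const (U H′ (suc zero) (suc zero))      ≈⟨ D.+-congˡ (D.-‿cong (const-cong U′₁₁≈)) ⟩
      X -ᵈ const (U H zero zero + d)               ≈⟨ D.+-congˡ (D.-‿cong (const-+ (U H zero zero) d)) ⟩
      X -ᵈ (const (U H zero zero) +ᵈ const d)      ≈⟨ D.solve 3 (λ X u d → X D.:- (u D.:+ d) D.:= (X D.:- u) D.:+ D.:- d)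
                                                              D.refl X (const (U H zero zero)) (const d) ⟩
      (X -ᵈ const (U H zero zero)) +ᵈ -ᵈ const d   ∎
    A₀ₜ≈ : ∀ t → A zero (suc t) ≈ᵈ B zero (suc t)
    A₀ₜ≈ t = charMatrix-cong (UMatDel ℝ a d H′ zero) (U H) zero (suc t) (U′₁ₜ≈ t)
    Aᵣₛ≈ : ∀ r s → A (suc r) s ≈ᵈ B (suc r) s
    Aᵣₛ≈ r s = charMatrix-cong (UMatDel ℝ a d H′ zero) (U H) (suc r) s (U′ᵣₛ≈ r s)
    B₀≈C : ∀ r s → B₀ r s ≈ᵈ C r s
    B₀≈C = charMatrix-minor (U H) (UMatDel ℝ a d H zero) (λ _ _ → refl)

  P′-recurrence : det (suc (suc m)) (charMatrix (U H′)) ≈ᵈ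
                  (X -ᵈ const d) *ᵈ det (suc m) (charMatrix (UMatDel ℝ a d H′ zero))
                    -ᵈ const (a * a) *ᵈ det m (charMatrix (UMatDel ℝ a d H zero))
  P′-recurrence = begin
    det (suc (suc m)) A
      ≈⟨ det-pendant m A A₀ₜ≈0 Aₜ₀≈0 ⟩
    A zero zero *ᵈ det (suc m) A₀ -ᵈ A zero (suc zero) *ᵈ A (suc zero) zero *ᵈ det m A₀₀
      ≈⟨ D.+-cong (D.*-cong A₀₀≈ (det-cong (suc m) A₀≈B))
                  (D.-‿cong (D.*-cong (D.*-cong A₀₁≈ A₁₀≈) (det-cong m A₀₀≈C))) ⟩
    (X -ᵈ const d) *ᵈ det (suc m) B -ᵈ (-ᵈ const a) *ᵈ (-ᵈ const a) *ᵈ det m C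
      ≈⟨ D.+-congˡ (D.-‿cong (D.*-congʳ [-a][-a]≈a²)) ⟩
    (X -ᵈ const d) *ᵈ det (suc m) B -ᵈ const (a * a) *ᵈ det m C
      ∎
    where
    open import Relation.Binary.Reasoning.Setoid D.setoid
    A : Fin (suc (suc m)) → Fin (suc (suc m)) → Dual
    A = charMatrix (U H′)
    A₀ B : Fin (suc m) → Fin (suc m) → Dual
    A₀ r s = A (suc r) (suc s)
    B = charMatrix (UMatDel ℝ a d H′ zero)
    A₀₀ C : Fin m → Fin m → Dual
    A₀₀ r s = A (suc (suc r)) (suc (suc s))
    C = charMatrix (UMatDel ℝ a d H zero)
    A₀₀≈ : A zero zero ≈ᵈ X -ᵈ const d
    A₀₀≈ = D.+-congˡ (D.-‿cong (const-cong (U-attach-00 H zero)))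
    A₀₁≈ : A zero (suc zero) ≈ᵈ -ᵈ const a
    A₀₁≈ = off-diagonal (trans (U-attach-0s H zero zero) (*-identityʳ a))
    A₁₀≈ : A (suc zero) zero ≈ᵈ -ᵈ const a
    A₁₀≈ = off-diagonal (trans (U-attach-s0 H zero zero) (*-identityʳ a))
    A₀ₜ≈0 : ∀ t → A zero (suc (suc t)) ≈ᵈ 0ᵈ
    A₀ₜ≈0 t = off-diagonal-zero (trans (U-attach-0s H zero (suc t)) (zeroʳ a))
    Aₜ₀≈0 : ∀ t → A (suc (suc t)) zero ≈ᵈ 0ᵈ
    Aₜ₀≈0 t = off-diagonal-zero (trans (U-attach-s0 H zero (suc t)) (zeroʳ a))
    A₀≈B : ∀ r s → A₀ r s ≈ᵈ B r s
    A₀≈B = charMatrix-minor (U H′) (UMatDel ℝ a d H′ zero) (λ _ _ → refl)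
    A₀₀≈C : ∀ r s → A₀₀ r s ≈ᵈ C r s
    A₀₀≈C r s = D.trans (A₀≈B (suc r) (suc s))
      (charMatrix-minor (UMatDel ℝ a d H′ zero) (UMatDel ℝ a d H zero) (λ r s → U′ᵣₛ≈ r (suc s)) r s)
    [-a][-a]≈a² : (-ᵈ const a) *ᵈ (-ᵈ const a) ≈ᵈ const (a * a)
    [-a][-a]≈a² = D.trans (D.solve 1 (λ α → (D.:- α) D.:* (D.:- α) D.:= α D.:* α) D.refl (const a))
                          (D.sym (const-* a a))

  wronskian-attach : evalP ℝ (wronskianAt H′ zero) x ≈
                     a * a * evalP ℝ (wronskianAt H zero) x
                       - evalP ℝ (charPolyUDel H′ zero) x * evalP ℝ (charPolyUDel H′ zero) x
  wronskian-attach = begin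
    evalP ℝ (wronskian P′ Q′) x
      ≈⟨ evalP-wronskian P′ Q′ ⟩
    wronskianᵈ (eval P′) (eval Q′)
      ≈⟨ wronskianᵈ-recurrence x d (a * a) eval-Q′ eval-P′ ⟩
    a * a * wronskianᵈ (eval P) (eval Q) - proj₁ (eval Q′) * proj₁ (eval Q′)
      ≈⟨ +-cong (*-congˡ (evalP-wronskian P Q)) (-‿cong (*-cong q′≈ q′≈)) ⟨
    a * a * evalP ℝ (wronskian P Q) x - evalP ℝ Q′ x * evalP ℝ Q′ x
      ∎
    where
    open import Relation.Binary.Reasoning.Setoid setoid
    P Q P′ Q′ : Poly ℝ
    P  = charPolyU H
    Q  = charPolyUDel H zero
    P′ = charPolyU H′
    Q′ = charPolyUDel H′ zero
    eval-Q′ : eval Q′ ≈ᵈ eval P -ᵈ const d *ᵈ eval Q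
    eval-Q′ = D.trans (eval-charPoly (UMatDel ℝ a d H′ zero)) (D.trans Q′-recurrence
      (D.sym (D.+-cong (eval-charPoly (U H)) (D.-‿cong (D.*-congˡ (eval-charPoly (UMatDel ℝ a d H zero)))))))
    eval-P′ : eval P′ ≈ᵈ (X -ᵈ const d) *ᵈ eval Q′ -ᵈ const (a * a) *ᵈ eval Q
    eval-P′ = D.trans (eval-charPoly (U H′)) (D.trans P′-recurrence
      (D.sym (D.+-cong (D.*-congˡ (eval-charPoly (UMatDel ℝ a d H′ zero)))
                       (D.-‿cong (D.*-congˡ (eval-charPoly (UMatDel ℝ a d H zero)))))))
    q′≈ : evalP ℝ Q′ x ≈ proj₁ (eval Q′)
    q′≈ = evalP≈proj₁-eval Q′

module OrderedFieldProperties (ℝ : CompleteOrderedField) where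
  open CompleteOrderedField ℝ hiding (zero; _<_; _≤_)
  open import Algebra.Properties.Ring ring using (-‿involutive)
  open import Relation.Binary.Bundles using (StrictTotalOrder; DecTotalOrder)
  open IntegerCoefficientSolver commutativeRing

  infix 4 _<_ _≤_
  _<_ _≤_ : Carrier → Carrier → Set
  _<_ = CompleteOrderedField._<_ ℝ
  _≤_ = CompleteOrderedField._≤_ ℝ

  <-strictTotalOrder : StrictTotalOrder _ _ _
  <-strictTotalOrder = record { isStrictTotalOrder = <-isStrictTotalOrder }

  open StrictTotalOrder <-strictTotalOrder public
    using (compare; asym; <-respˡ-≈; <-respʳ-≈; strictPartialOrder)
    renaming (trans to <-trans; irrefl to <-irrefl)
  open import Relation.Binary.Properties.StrictTotalOrder <-strictTotalOrder public
    using (decTotalOrder; ≤-respˡ-≈; ≤-respʳ-≈)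
    renaming (refl to ≤-refl; reflexive to ≤-reflexive; trans to ≤-trans; total to ≤-total;
              antisym to ≤-antisym)
  open import Algebra.Construct.NaturalChoice.Max (DecTotalOrder.totalOrder decTotalOrder) public
    using (_⊔_; x≤x⊔y; x≤y⊔x; ⊔-sel)
  module ≤-Reasoning = Relation.Binary.Reasoning.StrictPartialOrder strictPartialOrder

  ≤-<-trans : ∀ {x y z} → x ≤ y → y < z → x < z
  ≤-<-trans (inj₁ x<y) y<z = <-trans x<y y<z
  ≤-<-trans (inj₂ x≈y) y<z = <-respˡ-≈ (sym x≈y) y<z

  <-≤-trans : ∀ {x y z} → x < y → y ≤ z → x < z
  <-≤-trans x<y (inj₁ y<z) = <-trans x<y y<z
  <-≤-trans x<y (inj₂ y≈z) = <-respʳ-≈ y≈z x<y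

  <⇒≱ : ∀ {x y} → x < y → ¬ y ≤ x
  <⇒≱ x<y (inj₁ y<x) = asym x<y y<x
  <⇒≱ x<y (inj₂ y≈x) = <-irrefl (sym y≈x) x<y

  x<y⇒0<y-x : ∀ {x y} → x < y → 0# < y - x
  x<y⇒0<y-x {x} x<y = <-respˡ-≈ (-‿inverseʳ x) (+-mono-< (- x) x<y)

  <-by-difference : ∀ {x y} d → 0# < d → d ≈ y - x → x < y
  <-by-difference {x} {y} d 0<d d≈y-x = <-respʳ-≈ (solve 2 (λ x y → (y :- x) :+ x := y) refl x y)
    (<-respˡ-≈ (+-identityˡ x) (+-mono-< x (<-respʳ-≈ d≈y-x 0<d)))

  x≤y⇒0≤y-x : ∀ {x y} → x ≤ y → 0# ≤ y - x
  x≤y⇒0≤y-x     (inj₁ x<y) = inj₁ (x<y⇒0<y-x x<y)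
  x≤y⇒0≤y-x {x} (inj₂ x≈y) = inj₂ (sym (trans (+-congʳ (sym x≈y)) (-‿inverseʳ x)))

  ≤-by-difference : ∀ {x y} d → 0# ≤ d → d ≈ y - x → x ≤ y
  ≤-by-difference         d (inj₁ 0<d) d≈y-x = inj₁ (<-by-difference d 0<d d≈y-x)
  ≤-by-difference {x} {y} d (inj₂ 0≈d) d≈y-x = inj₂ (begin
    x             ≈⟨ +-identityˡ x ⟨
    0# + x        ≈⟨ +-congʳ (trans 0≈d d≈y-x) ⟩
    (y - x) + x   ≈⟨ solve 2 (λ x y → (y :- x) :+ x := y) refl x y ⟩
    y             ∎)
    where open import Relation.Binary.Reasoning.Setoid setoid

  x<0⇒0<-x : ∀ {x} → x < 0# → 0# < - x
  x<0⇒0<-x {x} x<0 = <-respʳ-≈ (+-identityˡ (- x)) (x<y⇒0<y-x x<0)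

  0<x⇒-x<0 : ∀ {x} → 0# < x → - x < 0#
  0<x⇒-x<0 {x} 0<x = <-by-difference x 0<x (sym (trans (+-identityˡ _) (-‿involutive x)))

  0<1 : 0# < 1#
  0<1 with compare 0# 1#
  ... | tri< 0<1 _ _ = 0<1
  ... | tri≈ _ 0≈1 _ = ⊥-elim (0≉1 0≈1)
  ... | tri> _ _ 1<0 = ⊥-elim (asym 1<0 (<-respʳ-≈ [-1][-1]≈1 (*-pos 0<-1 0<-1)))
    where
    0<-1 = x<0⇒0<-x 1<0
    [-1][-1]≈1 : - 1# * - 1# ≈ 1#
    [-1][-1]≈1 = solve 0 (:- con 1ℤ :* :- con 1ℤ := con 1ℤ) refl

  +-monoʳ-< : ∀ z {x y} → x < y → z + x < z + y
  +-monoʳ-< z {x} {y} x<y = <-respˡ-≈ (+-comm x z) (<-respʳ-≈ (+-comm y z) (+-mono-< z x<y))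

  +-monoˡ-≤ : ∀ z {x y} → x ≤ y → x + z ≤ y + z
  +-monoˡ-≤ z (inj₁ x<y) = inj₁ (+-mono-< z x<y)
  +-monoˡ-≤ z (inj₂ x≈y) = inj₂ (+-congʳ x≈y)

  +-monoʳ-≤ : ∀ z {x y} → x ≤ y → z + x ≤ z + y
  +-monoʳ-≤ z (inj₁ x<y) = inj₁ (+-monoʳ-< z x<y)
  +-monoʳ-≤ z (inj₂ x≈y) = inj₂ (+-congˡ x≈y)

  +-mono-≤ : ∀ {x y u v} → x ≤ y → u ≤ v → x + u ≤ y + v
  +-mono-≤ {y = y} {u} x≤y u≤v = ≤-trans (+-monoˡ-≤ u x≤y) (+-monoʳ-≤ y u≤v)

  0≤+ : ∀ {x y} → 0# ≤ x → 0# ≤ y → 0# ≤ x + y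
  0≤+ 0≤x 0≤y = ≤-respˡ-≈ (+-identityˡ 0#) (+-mono-≤ 0≤x 0≤y)

  0<+ : ∀ {x y} → 0# ≤ x → 0# < y → 0# < x + y
  0<+ {x} 0≤x 0<y = ≤-<-trans 0≤x (<-respˡ-≈ (+-identityʳ x) (+-monoʳ-< x 0<y))

  x<x+y : ∀ x {y} → 0# < y → x < x + y
  x<x+y x {y} 0<y = <-by-difference y 0<y (solve 2 (λ x y → y := (x :+ y) :- x) refl x y)

  x-y<x : ∀ x {y} → 0# < y → x - y < x
  x-y<x x {y} 0<y = <-by-difference y 0<y (solve 2 (λ x y → y := x :- (x :- y)) refl x y)

  0≤* : ∀ {x y} → 0# ≤ x → 0# ≤ y → 0# ≤ x * y
  0≤*         (inj₁ 0<x) (inj₁ 0<y) = inj₁ (*-pos 0<x 0<y)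
  0≤* {x}     (inj₁ _)   (inj₂ 0≈y) = inj₂ (sym (trans (*-congˡ (sym 0≈y)) (zeroʳ x)))
  0≤* {y = y} (inj₂ 0≈x) _          = inj₂ (sym (trans (*-congʳ (sym 0≈x)) (zeroˡ y)))

  *-monoˡ-< : ∀ {z x y} → 0# < z → x < y → z * x < z * y
  *-monoˡ-< {z} {x} {y} 0<z x<y = <-by-difference (z * (y - x)) (*-pos 0<z (x<y⇒0<y-x x<y))
    (solve 3 (λ z x y → z :* (y :- x) := z :* y :- z :* x) refl z x y)

  *-monoˡ-≤ : ∀ {z x y} → 0# ≤ z → x ≤ y → z * x ≤ z * y
  *-monoˡ-≤ {z} {x} {y} 0≤z x≤y = ≤-by-difference (z * (y - x)) (0≤* 0≤z (x≤y⇒0≤y-x x≤y))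
    (solve 3 (λ z x y → z :* (y :- x) := z :* y :- z :* x) refl z x y)

  *-mono-≤ : ∀ {x y u v} → 0# ≤ x → 0# ≤ u → x ≤ y → u ≤ v → x * u ≤ y * v
  *-mono-≤ {x} {y} {u} {v} 0≤x 0≤u x≤y u≤v = begin
    x * u   ≤⟨ *-monoˡ-≤ 0≤x u≤v ⟩
    x * v   ≈⟨ *-comm x v ⟩
    v * x   ≤⟨ *-monoˡ-≤ (≤-trans 0≤u u≤v) x≤y ⟩
    v * y   ≈⟨ *-comm v y ⟩
    y * v   ∎
    where open ≤-Reasoning

  *-cancelˡ-≤ : ∀ {z x y} → 0# < z → z * x ≤ z * y → x ≤ y
  *-cancelˡ-≤ {z} {x} {y} 0<z zx≤zy with compare x y
  ... | tri< x<y _ _ = inj₁ x<y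
  ... | tri≈ _ x≈y _ = inj₂ x≈y
  ... | tri> _ _ y<x = ⊥-elim (<⇒≱ (*-monoˡ-< 0<z y<x) zx≤zy)

  0<x*x : ∀ {x} → ¬ x ≈ 0# → 0# < x * x
  0<x*x {x} x≉0 with compare 0# x
  ... | tri< 0<x _ _ = *-pos 0<x 0<x
  ... | tri≈ _ 0≈x _ = ⊥-elim (x≉0 (sym 0≈x))
  ... | tri> _ _ x<0 = <-respʳ-≈ (solve 1 (λ x → :- x :* :- x := x :* x) refl x) (*-pos 0<-x 0<-x)
    where 0<-x = x<0⇒0<-x x<0

  0≤x*x : ∀ x → 0# ≤ x * x
  0≤x*x x with compare x 0#
  ... | tri< _ x≉0 _ = inj₁ (0<x*x x≉0)
  ... | tri≈ _ x≈0 _ = inj₂ (sym (trans (*-congˡ x≈0) (zeroʳ x)))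
  ... | tri> _ x≉0 _ = inj₁ (0<x*x x≉0)

  x-y*y≤x : ∀ x y → x - y * y ≤ x
  x-y*y≤x x y = ≤-by-difference (y * y) (0≤x*x y) (solve 2 (λ x y → y :* y := x :- (x :- y :* y)) refl x y)

  0<x*y⇒0<x : ∀ {x y} → 0# < y → 0# < x * y → 0# < x
  0<x*y⇒0<x {x} {y} 0<y 0<xy with compare 0# x
  ... | tri< 0<x _ _ = 0<x
  ... | tri≈ _ 0≈x _ = ⊥-elim (<-irrefl (sym (trans (*-congʳ (sym 0≈x)) (zeroˡ y))) 0<xy)
  ... | tri> _ _ x<0 = ⊥-elim (asym 0<xy (<-by-difference (- x * y) (*-pos (x<0⇒0<-x x<0) 0<y)
                                            (solve 2 (λ x y → :- x :* y := con 0ℤ :- x :* y) refl x y)))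

  0<x*y⇒0<y : ∀ {x y} → 0# < x → 0# < x * y → 0# < y
  0<x*y⇒0<y {x} {y} 0<x 0<xy = 0<x*y⇒0<x 0<x (<-respʳ-≈ (*-comm x y) 0<xy)

  0<x∧x*y≈1⇒0<y : ∀ {x y} → 0# < x → x * y ≈ 1# → 0# < y
  0<x∧x*y≈1⇒0<y {x} {y} 0<x xy≈1 with compare 0# y
  ... | tri< 0<y _ _ = 0<y
  ... | tri≈ _ 0≈y _ = ⊥-elim (0≉1 (trans (sym (zeroʳ x)) (trans (*-congˡ 0≈y) xy≈1)))
  ... | tri> _ _ y<0 = ⊥-elim (asym 0<1 (<-respˡ-≈ -[x*-y]≈1 (0<x⇒-x<0 (*-pos 0<x (x<0⇒0<-x y<0)))))
    where -[x*-y]≈1 = trans (solve 2 (λ x y → :- (x :* :- y) := x :* y) refl x y) xy≈1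

  two : Carrier
  two = 1# + 1#

  0≤two : 0# ≤ two
  0≤two = 0≤+ (inj₁ 0<1) (inj₁ 0<1)

  [x+y]²≤2[x²+y²] : ∀ x y → (x + y) * (x + y) ≤ two * (x * x + y * y)
  [x+y]²≤2[x²+y²] x y = ≤-by-difference ((x - y) * (x - y)) (0≤x*x (x - y))
    (solve 2 (λ x y → (x :- y) :* (x :- y) := (con 1ℤ :+ con 1ℤ) :* (x :* x :+ y :* y) :- (x :+ y) :* (x :+ y))
           refl x y)

  x*y≤0⇒y²≤[x-y]² : ∀ {x y} → x * y ≤ 0# → y * y ≤ (x - y) * (x - y)
  x*y≤0⇒y²≤[x-y]² {x} {y} xy≤0 =
    ≤-by-difference (x * x + two * (0# - x * y)) (0≤+ (0≤x*x x) (0≤* 0≤two (x≤y⇒0≤y-x xy≤0)))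
      (solve 2 (λ x y → x :* x :+ (con 1ℤ :+ con 1ℤ) :* (con 0ℤ :- x :* y) := (x :- y) :* (x :- y) :- y :* y)
             refl x y)

  x≉0∧y<0⇒x²y-z²<0 : ∀ {x y} z → ¬ x ≈ 0# → y < 0# → x * x * y - z * z < 0#
  x≉0∧y<0⇒x²y-z²<0 {x} z x≉0 y<0 =
    ≤-<-trans (x-y*y≤x _ z) (<-respʳ-≈ (zeroʳ (x * x)) (*-monoˡ-< (0<x*x x≉0) y<0))

module LeadingCoefficient (ℝ : CompleteOrderedField) where
  open CompleteOrderedField ℝ hiding (zero; _<_; _≤_)
  open import Algebra.Properties.Ring ring using (-0#≈0#; -‿involutive)
  open import Algebra.Properties.Monoid.Sum +-monoid using (sum)
  open PolynomialNotation ℝ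
  open IntegerCoefficientSolver commutativeRing
  open Determinant commutativeRing using (det; signed; identityMatrix; det-identity)
  open OrderedFieldProperties ℝ

  -- TopCoeff n c p: p = c xⁿ + (terms of lower degree).  The coefficient c may be 0, so
  -- TopCoeff n 0# p says that p has degree below n, and IsZeroPoly p that p vanishes.
  TopCoeff : ℕ → Carrier → Poly ℝ → Set
  TopCoeff n       c []      = c ≈ 0#
  TopCoeff zero    c (b ∷ p) = b ≈ c × TopCoeff zero 0# p
  TopCoeff (suc n) c (b ∷ p) = TopCoeff n c p

  IsZeroPoly : Poly ℝ → Set
  IsZeroPoly = TopCoeff zero 0#

  TopCoeff-cong : ∀ n {c c′} p → c ≈ c′ → TopCoeff n c p → TopCoeff n c′ p
  TopCoeff-cong n       []      c≈c′ c≈0         = trans (sym c≈c′) c≈0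
  TopCoeff-cong zero    (b ∷ p) c≈c′ (b≈c , p≈0) = trans b≈c c≈c′ , p≈0
  TopCoeff-cong (suc n) (b ∷ p) c≈c′ top         = TopCoeff-cong n p c≈c′ top

  IsZeroPoly⇒TopCoeff : ∀ n p → IsZeroPoly p → TopCoeff n 0# p
  IsZeroPoly⇒TopCoeff n       []      _         = refl
  IsZeroPoly⇒TopCoeff zero    (b ∷ p) p≈0       = p≈0
  IsZeroPoly⇒TopCoeff (suc n) (b ∷ p) (_ , p≈0) = IsZeroPoly⇒TopCoeff n p p≈0

  TopCoeff-lift : ∀ {k m c} p → k ℕ.< m → TopCoeff k c p → TopCoeff m 0# p
  TopCoeff-lift                 []      _         _         = refl
  TopCoeff-lift {zero}  {suc m} (b ∷ p) _         (_ , p≈0) = IsZeroPoly⇒TopCoeff m p p≈0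
  TopCoeff-lift {suc k} {suc m} (b ∷ p) (s≤s k<m) top       = TopCoeff-lift p k<m top

  TopCoeff-+ : ∀ n {c c′} p q → TopCoeff n c p → TopCoeff n c′ q → TopCoeff n (c + c′) (p +ₚ q)
  TopCoeff-+ n       []      q        c≈0 top′ =
    TopCoeff-cong n q (sym (trans (+-congʳ c≈0) (+-identityˡ _))) top′
  TopCoeff-+ n       (b ∷ p) []       top c′≈0 =
    TopCoeff-cong n (b ∷ p) (sym (trans (+-congˡ c′≈0) (+-identityʳ _))) top
  TopCoeff-+ zero    (b ∷ p) (b′ ∷ q) (b≈c , p≈0) (b′≈c′ , q≈0) =
    +-cong b≈c b′≈c′ , TopCoeff-cong zero (p +ₚ q) (+-identityˡ 0#) (TopCoeff-+ zero p q p≈0 q≈0)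
  TopCoeff-+ (suc n) (b ∷ p) (b′ ∷ q) top top′ = TopCoeff-+ n p q top top′

  TopCoeff-· : ∀ n a {c} q → TopCoeff n c q → TopCoeff n (a * c) (a ·ₚ q)
  TopCoeff-· n       a []      c≈0         = trans (*-congˡ c≈0) (zeroʳ a)
  TopCoeff-· zero    a (b ∷ q) (b≈c , q≈0) =
    *-congˡ b≈c , TopCoeff-cong zero (a ·ₚ q) (zeroʳ a) (TopCoeff-· zero a q q≈0)
  TopCoeff-· (suc n) a (b ∷ q) top         = TopCoeff-· n a q top

  TopCoeff-neg : ∀ n {c} p → TopCoeff n c p → TopCoeff n (- c) (-ₚ p)
  TopCoeff-neg n       []      c≈0         = trans (-‿cong c≈0) -0#≈0#
  TopCoeff-neg zero    (b ∷ p) (b≈c , p≈0) =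
    -‿cong b≈c , TopCoeff-cong zero (-ₚ p) -0#≈0# (TopCoeff-neg zero p p≈0)
  TopCoeff-neg (suc n) (b ∷ p) top         = TopCoeff-neg n p top

  IsZeroPoly-· : ∀ {a} q → a ≈ 0# → IsZeroPoly (a ·ₚ q)
  IsZeroPoly-·     []      _   = refl
  IsZeroPoly-· {a} (b ∷ q) a≈0 = trans (*-congʳ a≈0) (zeroˡ b) , IsZeroPoly-· q a≈0

  IsZeroPoly-*ˡ : ∀ p q → IsZeroPoly p → IsZeroPoly (p *ₚ q)
  IsZeroPoly-*ˡ []      q _           = refl
  IsZeroPoly-*ˡ (b ∷ p) q (b≈0 , p≈0) = TopCoeff-cong zero (b ·ₚ q +ₚ (0# ∷ p *ₚ q)) (+-identityˡ 0#)
    (TopCoeff-+ zero (b ·ₚ q) (0# ∷ p *ₚ q) (IsZeroPoly-· q b≈0) (refl , IsZeroPoly-*ˡ p q p≈0))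

  IsZeroPoly-*ʳ : ∀ p q → IsZeroPoly q → IsZeroPoly (p *ₚ q)
  IsZeroPoly-*ʳ []      q _   = refl
  IsZeroPoly-*ʳ (b ∷ p) q q≈0 =
    TopCoeff-cong zero (b ·ₚ q +ₚ (0# ∷ p *ₚ q)) (trans (+-congʳ (zeroʳ b)) (+-identityˡ 0#))
      (TopCoeff-+ zero (b ·ₚ q) (0# ∷ p *ₚ q) (TopCoeff-· zero b q q≈0) (refl , IsZeroPoly-*ʳ p q q≈0))

  TopCoeff-* : ∀ n k {c c′} p q → TopCoeff n c p → TopCoeff k c′ q → TopCoeff (n ℕ.+ k) (c * c′) (p *ₚ q)
  TopCoeff-* n       k {c} {c′} []      q c≈0 _ = trans (*-congʳ c≈0) (zeroˡ c′)
  TopCoeff-* zero    k          (b ∷ p) q (b≈c , p≈0) top′ =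
    TopCoeff-cong k (b ·ₚ q +ₚ (0# ∷ p *ₚ q)) (trans (+-identityʳ _) (*-congʳ b≈c))
      (TopCoeff-+ k (b ·ₚ q) (0# ∷ p *ₚ q) (TopCoeff-· k b q top′)
        (IsZeroPoly⇒TopCoeff k (0# ∷ p *ₚ q) (refl , IsZeroPoly-*ˡ p q p≈0)))
  TopCoeff-* (suc n) k          (b ∷ p) q top top′ =
    TopCoeff-cong (suc n ℕ.+ k) (b ·ₚ q +ₚ (0# ∷ p *ₚ q)) (+-identityˡ _)
      (TopCoeff-+ (suc n ℕ.+ k) (b ·ₚ q) (0# ∷ p *ₚ q)
        (TopCoeff-lift (b ·ₚ q) (s≤s (ℕₚ.m≤n+m k n)) (TopCoeff-· k b q top′))
        (TopCoeff-* n k p q top top′))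

  TopCoeff-signP : ∀ m n {c} p → TopCoeff n c p → TopCoeff n (signed m c) (signP ℝ m p)
  TopCoeff-signP zero          n p top = top
  TopCoeff-signP (suc zero)    n p top = TopCoeff-neg n p top
  TopCoeff-signP (suc (suc m)) n p top = TopCoeff-signP m n p top

  TopCoeff-sumP : ∀ n {k} {c : Fin k → Carrier} (f : Fin k → Poly ℝ) →
                  (∀ j → TopCoeff n (c j) (f j)) → TopCoeff n (sum c) (sumP ℝ f)
  TopCoeff-sumP n {zero}  f _   = refl
  TopCoeff-sumP n {suc k} f top = TopCoeff-+ n (f zero) (sumP ℝ (λ j → f (suc j))) (top zero)
                                    (TopCoeff-sumP n (λ j → f (suc j)) (λ j → top (suc j)))

  TopCoeff-detP : ∀ k (M : Fin k → Fin k → Poly ℝ) (L : Fin k → Fin k → Carrier) →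
                  (∀ i j → TopCoeff 1 (L i j) (M i j)) → TopCoeff k (det k L) (detP ℝ k M)
  TopCoeff-detP zero    M L _   = refl , refl
  TopCoeff-detP (suc k) M L top = TopCoeff-sumP (suc k) term λ j →
    TopCoeff-signP (toℕ j) (suc k) _ (TopCoeff-* 1 k (M zero j) _ (top zero j)
      (TopCoeff-detP k (minorP j) (λ r s → L (suc r) (punchIn j s)) (λ r s → top (suc r) (punchIn j s))))
    where
    minorP : Fin (suc k) → Fin k → Fin k → Poly ℝ
    minorP j r s = M (suc r) (punchIn j s)
    term : Fin (suc k) → Poly ℝ
    term j = signP ℝ (toℕ j) (M zero j *ₚ detP ℝ k (minorP j))

  TopCoeff-charPoly : ∀ {k} (M : Matrix ℝ k) → TopCoeff k 1# (charPoly ℝ M)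
  TopCoeff-charPoly {k} M = TopCoeff-cong k (charPoly ℝ M) (det-identity k)
    (TopCoeff-detP k _ identityMatrix (λ i j → entry (isYes (i ≟ j)) (M i j)))
    where
    entry : ∀ b u → TopCoeff 1 (if b then 1# else 0#) (if b then (- u) ∷ 1# ∷ [] else (- u) ∷ [])
    entry true  u = refl , refl
    entry false u = refl

  TopCoeff-derivFrom : ∀ k n {c} p → TopCoeff n c p → TopCoeff n (natC ℝ (k ℕ.+ n) * c) (derivFrom ℝ k p)
  TopCoeff-derivFrom k n       []      c≈0 = trans (*-congˡ c≈0) (zeroʳ _)
  TopCoeff-derivFrom k zero    (b ∷ p) (b≈c , p≈0) =
    *-cong (reflexive (≡.cong (natC ℝ) (≡.sym (ℕₚ.+-identityʳ k)))) b≈c ,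
    TopCoeff-cong zero (derivFrom ℝ (suc k) p) (zeroʳ _) (TopCoeff-derivFrom (suc k) zero p p≈0)
  TopCoeff-derivFrom k (suc n) (b ∷ p) top =
    TopCoeff-cong n (derivFrom ℝ (suc k) p) (*-congʳ (reflexive (≡.cong (natC ℝ) (≡.sym (ℕₚ.+-suc k n)))))
      (TopCoeff-derivFrom (suc k) n p top)

  TopCoeff-∂ : ∀ n {c} p → TopCoeff (suc n) c p → TopCoeff n (natC ℝ (suc n) * c) (∂ p)
  TopCoeff-∂ n []      c≈0 = trans (*-congˡ c≈0) (zeroʳ _)
  TopCoeff-∂ n (b ∷ p) top = TopCoeff-derivFrom 1 n p top

  IsZeroPoly-∂ : ∀ {c} p → TopCoeff zero c p → IsZeroPoly (∂ p)
  IsZeroPoly-∂ []      _         = refl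
  IsZeroPoly-∂ (b ∷ p) (_ , p≈0) = TopCoeff-cong zero (derivFrom ℝ 1 p) (zeroʳ _) (TopCoeff-derivFrom 1 zero p p≈0)

  TopCoeff-wronskian : ∀ n P Q → TopCoeff (suc n) 1# P → TopCoeff n 1# Q →
                       TopCoeff (n ℕ.+ n) (- 1#) (wronskian P Q)
  TopCoeff-wronskian zero P Q P-top Q-top =
    TopCoeff-cong zero (wronskian P Q)
      (solve 0 (con 0ℤ :+ :- ((con 1ℤ :+ con 0ℤ) :* con 1ℤ :* con 1ℤ) := :- con 1ℤ) refl)
      (TopCoeff-+ zero (P *ₚ ∂ Q) (-ₚ (∂ P *ₚ Q))
        (IsZeroPoly-*ʳ P (∂ Q) (IsZeroPoly-∂ Q Q-top))
        (TopCoeff-neg zero (∂ P *ₚ Q) (TopCoeff-* zero zero (∂ P) Q (TopCoeff-∂ zero P P-top) Q-top)))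
  TopCoeff-wronskian (suc m) P Q P-top Q-top =
    TopCoeff-cong (suc m ℕ.+ suc m) (wronskian P Q)
      (solve 1 (λ N → con 1ℤ :* (N :* con 1ℤ) :+ :- ((con 1ℤ :+ N) :* con 1ℤ :* con 1ℤ) := :- con 1ℤ)
             refl (natC ℝ (suc m)))
      (TopCoeff-+ (suc m ℕ.+ suc m) (P *ₚ ∂ Q) (-ₚ (∂ P *ₚ Q))
        (≡.subst (λ i → TopCoeff i (1# * (natC ℝ (suc m) * 1#)) (P *ₚ ∂ Q)) (≡.cong suc (≡.sym (ℕₚ.+-suc m m)))
          (TopCoeff-* (suc (suc m)) m P (∂ Q) P-top (TopCoeff-∂ m Q Q-top)))
        (TopCoeff-neg (suc m ℕ.+ suc m) (∂ P *ₚ Q)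
          (TopCoeff-* (suc m) (suc m) (∂ P) Q (TopCoeff-∂ (suc m) P P-top) Q-top)))

  evalP-IsZeroPoly : ∀ p y → IsZeroPoly p → evalP ℝ p y ≈ 0#
  evalP-IsZeroPoly []      y _           = refl
  evalP-IsZeroPoly (b ∷ p) y (b≈0 , p≈0) =
    trans (+-cong b≈0 (trans (*-congˡ (evalP-IsZeroPoly p y p≈0)) (zeroʳ y))) (+-identityˡ 0#)

  TopCoeff-1⇒eventually-≥1 : ∀ n p → TopCoeff n 1# p → ∃ λ R → ∀ y → R ≤ y → 1# ≤ evalP ℝ p y
  TopCoeff-1⇒eventually-≥1 n       []      1≈0         = ⊥-elim (0≉1 (sym 1≈0))
  TopCoeff-1⇒eventually-≥1 zero    (b ∷ p) (b≈1 , p≈0) = 0# , λ y _ → ≤-reflexive (sym (begin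
    b + y * evalP ℝ p y   ≈⟨ +-cong b≈1 (*-congˡ (evalP-IsZeroPoly p y p≈0)) ⟩
    1# + y * 0#           ≈⟨ +-congˡ (zeroʳ y) ⟩
    1# + 0#               ≈⟨ +-identityʳ 1# ⟩
    1#                    ∎))
    where open import Relation.Binary.Reasoning.Setoid setoid
  TopCoeff-1⇒eventually-≥1 (suc n) (b ∷ g) top with TopCoeff-1⇒eventually-≥1 n g top
  ... | R′ , g≥1 = R′ ⊔ S , λ y R≤y → let S≤y = ≤-trans (x≤y⊔x R′ S) R≤y in begin
    1#                    ≈⟨ solve 1 (λ b → con 1ℤ := b :+ (con 1ℤ :- b)) refl b ⟩
    b + (1# - b)          ≤⟨ +-monoʳ-≤ b (≤-trans (x≤y⊔x 0# (1# - b)) S≤y) ⟩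
    b + y                 ≈⟨ +-congˡ (*-identityʳ y) ⟨
    b + y * 1#            ≤⟨ +-monoʳ-≤ b (*-monoˡ-≤ (≤-trans (x≤x⊔y 0# (1# - b)) S≤y)
                                                    (g≥1 y (≤-trans (x≤x⊔y R′ S) R≤y))) ⟩
    b + y * evalP ℝ g y   ∎
    where
    open ≤-Reasoning
    S = 0# ⊔ (1# - b)

  TopCoeff-[-1]⇒eventually-<0 : ∀ n p → TopCoeff n (- 1#) p → ∃ λ R → ∀ y → R ≤ y → evalP ℝ p y < 0#
  TopCoeff-[-1]⇒eventually-<0 n p top = proj₁ -p≥1 , p<0
    where
    -p≥1 = TopCoeff-1⇒eventually-≥1 n (-ₚ p) (TopCoeff-cong n (-ₚ p) (-‿involutive 1#) (TopCoeff-neg n p top))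
    p<0 : ∀ y → proj₁ -p≥1 ≤ y → evalP ℝ p y < 0#
    p<0 y R≤y = <-respˡ-≈ (trans (-‿cong (DualEvaluation.evalP-neg ℝ y p)) (-‿involutive _))
                          (0<x⇒-x<0 (<-≤-trans 0<1 (proj₂ -p≥1 y R≤y)))

module IntermediateValue (ℝ : CompleteOrderedField) where
  open CompleteOrderedField ℝ hiding (zero; _<_; _≤_)
  open OrderedFieldProperties ℝ
  open IntegerCoefficientSolver commutativeRing

  -- For p = c + x g one has p(y) − p(s) = (y − s) g(y) + s (g(y) − g(s)); bounding each
  -- square with (u + v)² ≤ 2(u² + v²) and using δ ≤ 1 gives the recursion below.
  lipschitz : Carrier → Poly ℝ → Carrier
  lipschitz s []      = 0#
  lipschitz s (_ ∷ g) = two * (two * (evalP ℝ g s * evalP ℝ g s + lipschitz s g) + s * s * lipschitz s g)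

  0≤lipschitz : ∀ s p → 0# ≤ lipschitz s p
  0≤lipschitz s []      = ≤-refl
  0≤lipschitz s (_ ∷ g) =
    0≤* 0≤two (0≤+ (0≤* 0≤two (0≤+ (0≤x*x _) (0≤lipschitz s g))) (0≤* (0≤x*x s) (0≤lipschitz s g)))

  evalP-lipschitz : ∀ s p {y δ} → δ ≤ 1# → (y - s) * (y - s) ≤ δ →
                    (evalP ℝ p y - evalP ℝ p s) * (evalP ℝ p y - evalP ℝ p s) ≤ lipschitz s p * δ
  evalP-lipschitz s []      {δ = δ} _ _ =
    ≤-reflexive (solve 1 (λ δ → (con 0ℤ :- con 0ℤ) :* (con 0ℤ :- con 0ℤ) := con 0ℤ :* δ) refl δ)
  evalP-lipschitz s (c ∷ g) {y} {δ} δ≤1 h²≤δ = begin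
    ((c + y * u) - (c + s * v)) * ((c + y * u) - (c + s * v))
      ≈⟨ *-cong split split ⟩
    (h * u + s * e) * (h * u + s * e)
      ≤⟨ [x+y]²≤2[x²+y²] (h * u) (s * e) ⟩
    two * ((h * u) * (h * u) + (s * e) * (s * e))
      ≈⟨ *-congˡ (+-cong (square-* h u) (square-* s e)) ⟩
    two * ((h * h) * (u * u) + (s * s) * (e * e))
      ≤⟨ *-monoˡ-≤ 0≤two (+-mono-≤ (*-mono-≤ (0≤x*x h) (0≤x*x u) h²≤δ u²≤) (*-monoˡ-≤ (0≤x*x s) e²≤)) ⟩
    two * (δ * (two * (v * v + L)) + (s * s) * (L * δ))
      ≈⟨ solve 5 (λ δ v L s t → t :* (δ :* (t :* (v :* v :+ L)) :+ (s :* s) :* (L :* δ))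
                             := t :* (t :* (v :* v :+ L) :+ s :* s :* L) :* δ) refl δ v L s two ⟩
    lipschitz s (c ∷ g) * δ
      ∎
    where
    open ≤-Reasoning
    u = evalP ℝ g y
    v = evalP ℝ g s
    h = y - s
    e = u - v
    L = lipschitz s g
    split : (c + y * u) - (c + s * v) ≈ h * u + s * e
    split = solve 5 (λ c y u s v → (c :+ y :* u) :- (c :+ s :* v) := (y :- s) :* u :+ s :* (u :- v))
                    refl c y u s v
    square-* : ∀ a b → (a * b) * (a * b) ≈ (a * a) * (b * b)
    square-* = solve 2 (λ a b → (a :* b) :* (a :* b) := (a :* a) :* (b :* b)) refl
    e²≤ : e * e ≤ L * δ
    e²≤ = evalP-lipschitz s g δ≤1 h²≤δ
    u²≤ : u * u ≤ two * (v * v + L)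
    u²≤ = begin
      u * u                   ≈⟨ *-cong u≈v+e u≈v+e ⟩
      (v + e) * (v + e)       ≤⟨ [x+y]²≤2[x²+y²] v e ⟩
      two * (v * v + e * e)   ≤⟨ *-monoˡ-≤ 0≤two (+-monoʳ-≤ (v * v) (≤-trans e²≤ Lδ≤L)) ⟩
      two * (v * v + L)       ∎
      where
      u≈v+e = solve 2 (λ u v → u := v :+ (u :- v)) refl u v
      Lδ≤L : L * δ ≤ L
      Lδ≤L = ≤-respʳ-≈ (*-identityʳ L) (*-monoˡ-≤ (0≤lipschitz s g) δ≤1)

  module _ (p : Poly ℝ) (s : Carrier) (p[s]≉0 : ¬ evalP ℝ p s ≈ 0#) where
    private
      c L t : Carrier
      c = evalP ℝ p s
      L = lipschitz s p
      t = L + c * c + 1#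

      0<t : 0# < t
      0<t = 0<+ (0≤+ (0≤lipschitz s p) (0≤x*x c)) 0<1

      t≉0 : ¬ t ≈ 0#
      t≉0 t≈0 = <-irrefl (sym t≈0) 0<t

      t⁻¹ : Carrier
      t⁻¹ = proj₁ (inverse t t≉0)

      tt⁻¹≈1 : t * t⁻¹ ≈ 1#
      tt⁻¹≈1 = proj₂ (inverse t t≉0)

      δ : Carrier
      δ = c * c * t⁻¹

      0<δ : 0# < δ
      0<δ = *-pos (0<x*x p[s]≉0) (0<x∧x*y≈1⇒0<y 0<t tt⁻¹≈1)

      tδ≈c² : t * δ ≈ c * c
      tδ≈c² = begin
        t * (c * c * t⁻¹)   ≈⟨ solve 3 (λ t c i → t :* (c :* c :* i) := c :* c :* (t :* i)) refl t c t⁻¹ ⟩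
        c * c * (t * t⁻¹)   ≈⟨ *-congˡ tt⁻¹≈1 ⟩
        c * c * 1#          ≈⟨ *-identityʳ _ ⟩
        c * c               ∎
        where open import Relation.Binary.Reasoning.Setoid setoid

      δ≤1 : δ ≤ 1#
      δ≤1 = *-cancelˡ-≤ 0<t (begin
        t * δ    ≈⟨ tδ≈c² ⟩
        c * c    ≤⟨ ≤-by-difference (L + 1#) (0≤+ (0≤lipschitz s p) (inj₁ 0<1))
                                    (solve 3 (λ L c d → L :+ d := (L :+ c :* c :+ d) :- c :* c) refl L c 1#) ⟩
        t        ≈⟨ *-identityʳ t ⟨
        t * 1#   ∎)
        where open ≤-Reasoning

      Lδ<c² : L * δ < c * c
      Lδ<c² = begin-strict
        L * δ   ≈⟨ *-comm L δ ⟩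
        δ * L   <⟨ *-monoˡ-< 0<δ (<-by-difference (c * c + 1#) (0<+ (0≤x*x c) 0<1)
                                   (solve 3 (λ L c d → c :* c :+ d := (L :+ c :* c :+ d) :- L) refl L c 1#)) ⟩
        δ * t   ≈⟨ *-comm δ t ⟩
        t * δ   ≈⟨ tδ≈c² ⟩
        c * c   ∎
        where open ≤-Reasoning

      [y-s]²≤δ : ∀ {y} → s - δ ≤ y → y ≤ s + δ → (y - s) * (y - s) ≤ δ
      [y-s]²≤δ {y} s-δ≤y y≤s+δ = begin
        (y - s) * (y - s)   ≤⟨ ≤-by-difference (((s + δ) - y) * (y - (s - δ)))
                                 (0≤* (x≤y⇒0≤y-x y≤s+δ) (x≤y⇒0≤y-x s-δ≤y))
                                 (solve 3 (λ y s δ → ((s :+ δ) :- y) :* (y :- (s :- δ))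
                                                     := δ :* δ :- (y :- s) :* (y :- s)) refl y s δ) ⟩
        δ * δ               ≤⟨ *-monoˡ-≤ (inj₁ 0<δ) δ≤1 ⟩
        δ * 1#              ≈⟨ *-identityʳ δ ⟩
        δ                   ∎
        where open ≤-Reasoning

      sign-kept : ∀ {y} → s - δ ≤ y → y ≤ s + δ → ¬ evalP ℝ p y * c ≤ 0#
      sign-kept s-δ≤y y≤s+δ p[y]c≤0 =
        <⇒≱ (≤-<-trans (evalP-lipschitz s p δ≤1 ([y-s]²≤δ s-δ≤y y≤s+δ)) Lδ<c²) (x*y≤0⇒y²≤[x-y]² p[y]c≤0)

    evalP-signStable : ∃ λ δ → 0# < δ × (∀ y → s - δ ≤ y → y ≤ s + δ → 0# < evalP ℝ p y * evalP ℝ p s)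
    evalP-signStable = δ , 0<δ , stable
      where
      stable : ∀ y → s - δ ≤ y → y ≤ s + δ → 0# < evalP ℝ p y * c
      stable y s-δ≤y y≤s+δ with compare 0# (evalP ℝ p y * c)
      ... | tri< 0<p[y]c _ _ = 0<p[y]c
      ... | tri≈ _ 0≈p[y]c _ = ⊥-elim (sign-kept s-δ≤y y≤s+δ (inj₂ (sym 0≈p[y]c)))
      ... | tri> _ _ p[y]c<0 = ⊥-elim (sign-kept s-δ≤y y≤s+δ (inj₁ p[y]c<0))

  evalP-cong : ∀ p {x y} → x ≈ y → evalP ℝ p x ≈ evalP ℝ p y
  evalP-cong []      x≈y = refl
  evalP-cong (c ∷ p) x≈y = +-congˡ (*-cong x≈y (evalP-cong p x≈y))

  -- If p(x₀) > 0, let s be the supremum of the points up to which p stays positive from x₀.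
  -- Then p(s) > 0 as well, and by sign stability p stays positive a little beyond s.
  module _ (p : Poly ℝ) (p≉0 : ∀ y → ¬ evalP ℝ p y ≈ 0#)
           (R : Carrier) (p<0 : ∀ y → R ≤ y → evalP ℝ p y < 0#)
           (x₀ : Carrier) (0<p[x₀] : 0# < evalP ℝ p x₀) where
    private
      PositiveUpTo : Carrier → Set
      PositiveUpTo y = x₀ ≤ y × (∀ z → x₀ ≤ z → z ≤ y → 0# < evalP ℝ p z)

      x₀-positive : PositiveUpTo x₀
      x₀-positive = ≤-refl , λ z x₀≤z z≤x₀ → <-respʳ-≈ (evalP-cong p (≤-antisym x₀≤z z≤x₀)) 0<p[x₀]

      bounded : ∀ y → PositiveUpTo y → y ≤ R ⊔ x₀
      bounded y (_ , positive) with ≤-total y (R ⊔ x₀)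
      ... | inj₁ y≤B = y≤B
      ... | inj₂ B≤y = ⊥-elim (asym (p<0 (R ⊔ x₀) (x≤x⊔y R x₀)) (positive (R ⊔ x₀) (x≤y⊔x R x₀) B≤y))

      supremum = complete PositiveUpTo (x₀ , x₀-positive) (R ⊔ x₀ , bounded)

      s : Carrier
      s = proj₁ supremum

      s-upper : ∀ y → PositiveUpTo y → y ≤ s
      s-upper = proj₁ (proj₂ supremum)

      s-least : ∀ b → (∀ y → PositiveUpTo y → y ≤ b) → s ≤ b
      s-least = proj₂ (proj₂ supremum)

      x₀≤s : x₀ ≤ s
      x₀≤s = s-upper x₀ x₀-positive

      positive-below-s : ∀ z → x₀ ≤ z → z < s → 0# < evalP ℝ p z
      positive-below-s z x₀≤z z<s with compare 0# (evalP ℝ p z)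
      ... | tri< 0<p[z] _ _ = 0<p[z]
      ... | tri≈ _ 0≈p[z] _ = ⊥-elim (p≉0 z (sym 0≈p[z]))
      ... | tri> _ _ p[z]<0 = ⊥-elim (<⇒≱ z<s (s-least z z-bounds))
        where
        z-bounds : ∀ y → PositiveUpTo y → y ≤ z
        z-bounds y (_ , positive) with ≤-total y z
        ... | inj₁ y≤z = y≤z
        ... | inj₂ z≤y = ⊥-elim (asym p[z]<0 (positive z x₀≤z z≤y))

      δ : Carrier
      δ = proj₁ (evalP-signStable p s (p≉0 s))

      0<δ : 0# < δ
      0<δ = proj₁ (proj₂ (evalP-signStable p s (p≉0 s)))

      stable : ∀ y → s - δ ≤ y → y ≤ s + δ → 0# < evalP ℝ p y * evalP ℝ p s
      stable = proj₂ (proj₂ (evalP-signStable p s (p≉0 s)))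

      0<p[s] : 0# < evalP ℝ p s
      0<p[s] with x₀≤s
      ... | inj₂ x₀≈s = 0<x*y⇒0<y 0<p[x₀] (stable x₀ (≤-respʳ-≈ (sym x₀≈s) (inj₁ (x-y<x s 0<δ)))
                                                     (≤-respˡ-≈ (sym x₀≈s) (inj₁ (x<x+y s 0<δ))))
      ... | inj₁ x₀<s = 0<x*y⇒0<y (positive-below-s z (x≤x⊔y x₀ (s - δ)) z<s)
                                  (stable z (x≤y⊔x x₀ (s - δ)) (inj₁ (<-trans z<s (x<x+y s 0<δ))))
        where
        z = x₀ ⊔ (s - δ)
        z<s : z < s
        z<s with ⊔-sel x₀ (s - δ)
        ... | inj₁ z≈x₀  = <-respˡ-≈ (sym z≈x₀) x₀<s
        ... | inj₂ z≈s-δ = <-respˡ-≈ (sym z≈s-δ) (x-y<x s 0<δ)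

      s+δ-positive : PositiveUpTo (s + δ)
      s+δ-positive = ≤-trans x₀≤s (inj₁ (x<x+y s 0<δ)) , positive
        where
        positive : ∀ z → x₀ ≤ z → z ≤ s + δ → 0# < evalP ℝ p z
        positive z x₀≤z z≤s+δ with compare z s
        ... | tri< z<s _ _ = positive-below-s z x₀≤z z<s
        ... | tri≈ _ z≈s _ = 0<x*y⇒0<x 0<p[s] (stable z (≤-respʳ-≈ (sym z≈s) (inj₁ (x-y<x s 0<δ))) z≤s+δ)
        ... | tri> _ _ s<z = 0<x*y⇒0<x 0<p[s] (stable z (inj₁ (<-trans (x-y<x s 0<δ) s<z)) z≤s+δ)

    no-sign-change : ⊥
    no-sign-change = <⇒≱ (x<x+y s 0<δ) (s-upper (s + δ) s+δ-positive)

  evalP-negative : ∀ p → (∀ y → ¬ evalP ℝ p y ≈ 0#) → (∃ λ R → ∀ y → R ≤ y → evalP ℝ p y < 0#) →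
                   ∀ x → evalP ℝ p x < 0#
  evalP-negative p p≉0 (R , p<0) x with compare (evalP ℝ p x) 0#
  ... | tri< p[x]<0 _ _ = p[x]<0
  ... | tri≈ _ p[x]≈0 _ = ⊥-elim (p≉0 x p[x]≈0)
  ... | tri> _ _ 0<p[x] = ⊥-elim (no-sign-change p p≉0 R p<0 x 0<p[x])

module PendantPathWronskian (ℝ : CompleteOrderedField) (a d : CompleteOrderedField.Carrier ℝ)
                            (a≉0 : ¬ CompleteOrderedField._≈_ ℝ a (CompleteOrderedField.0# ℝ))
                            (G : Graph) (v : Fin (size G)) where
  open CompleteOrderedField ℝ hiding (zero; _<_; _≤_)
  open OrderedFieldProperties ℝ
  open PendantVertex ℝ a d using (U; charPolyU; charPolyUDel; wronskianAt)
  open LeadingCoefficient ℝ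
  open IntermediateValue ℝ using (evalP-negative)

  W : ℕ → Poly ℝ
  W n = wronskianAt (pathGraph G v n) (pathEnd G v n)

  W₁-eventually-negative : ∃ λ R → ∀ y → R ≤ y → evalP ℝ (W 1) y < 0#
  W₁-eventually-negative = TopCoeff-[-1]⇒eventually-<0 (k ℕ.+ k) (W 1)
    (TopCoeff-wronskian k (charPolyU H) (charPolyUDel H zero)
      (TopCoeff-charPoly (U H)) (TopCoeff-charPoly (UMatDel ℝ a d H zero)))
    where
    H = attach G v
    k = size G

  W-negative : (∀ x → ¬ evalP ℝ (W 1) x ≈ 0#) → ∀ n → 1 ℕ.≤ n → ∀ x → evalP ℝ (W n) x < 0#
  W-negative W₁≉0 (suc zero)    _   = evalP-negative (W 1) W₁≉0 W₁-eventually-negative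
  W-negative W₁≉0 (suc (suc n)) _ x =
    <-respˡ-≈ (sym (wronskian-attach (pathGraph G v n) (pathEnd G v n) x))
              (x≉0∧y<0⇒x²y-z²<0 _ a≉0 (W-negative W₁≉0 (suc n) (s≤s z≤n) x))
    where open PendantStep ℝ a d using (wronskian-attach)

open import Data.Nat using (_≤_)

theorem4p1 : (ℝ : CompleteOrderedField) →
             (a d : CompleteOrderedField.Carrier ℝ) →
             ¬ (CompleteOrderedField._≈_ ℝ a (CompleteOrderedField.0# ℝ)) →
             (G : Graph) (v : Fin' G) →
             IsWronskian ℝ a d (pathGraph G v 1) (pathEnd G v 1) →
             ∀ (n : ℕ) → 1 ≤ n →
             IsWronskian ℝ a d (pathGraph G v n) (pathEnd G v n)
theorem4p1 ℝ a d a≉0 G v W₁≉0 n 1≤n x Wₙ≈0 = <-irrefl Wₙ≈0 (W-negative W₁≉0 n 1≤n x)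
  where
  open PendantPathWronskian ℝ a d a≉0 G v
  open OrderedFieldProperties ℝ using (<-irrefl)
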